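{- Let $M$ be an $n\times n$ matrix over a commutative ring with associated column graph $G^X=G^X(M)$, and let $(T,\chi)$ be a tree decomposition of $G^X$ of width $\omega$. Then $\mathrm{Perm}(M)$ can be computed using $\widetilde{O}(n\,4^{\omega})$ arithmetic operations.
   Context: The rows of $M$ are indexed by a set $A$ and the columns by a set $X$, $|A|=|X|=n$. The permanent is $\mathrm{Perm}(M)=\sum_{\pi}\prod_{a\in A}M_{a,\pi(a)}$, over all bijections $\pi:A\to X$. For $a\in A$ let $X(a)\subset X$ be the set of columns $x$ with $M_{a,x}\neq0$. The column graph $G^X(M)$ has vertex set $X$ and an edge $(x_i,x_j)$ whenever $x_i,x_j\in X(a)$ for some $a\in A$. A tree decomposition of a graph with vertex set $X$ is a pair $(T,\chi)$ with $T$ a rooted tree and $\chi(t)\subset X$ for each node $t$, such that the union of the $\chi(t)$ is $X$, every edge has both endpoints in some $\chi(t)$, and for each vertex $x$ the nodes $t$ with $x\in\chi(t)$ form a subtree; its width is $\max_t|\chi(t)|-1$. As a standing convention, tree decompositions are taken to have $O(n)$ nodes. The notation $\widetilde{O}$ suppresses factors polynomial in $\omega$. -}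

module Defs where

open import Level using (Level; _⊔_)
open import Algebra.Bundles using (CommutativeRing)
open import Data.Nat using (ℕ; zero; suc; _≤_)
open import Data.Fin using (Fin; zero; suc; toℕ; _≟_)
open import Data.Fin.Subset using (Subset; _∈_; _∉_; ∣_∣)
open import Data.Vec using (Vec; []; _∷_; _∷ʳ_; lookup)
open import Data.List using (List; [_]; map; concatMap; allFin; filterᵇ; foldr)
open import Data.Bool.ListAction using (all; any)
open import Data.Bool using (Bool; not; _∨_; _∧_)
open import Data.Product using (Σ; ∃; ∃-syntax; _×_; _,_)
open import Relation.Nullary using (¬_)
open import Relation.Nullary.Decidable using (⌊_⌋)
open import Relation.Binary.PropositionalEquality using (_≡_; _≢_)

-- Straight-line programs (arithmetic circuits with sharing) whose inputs
-- are the n×n matrix entries.  Cost = number of arithmetic operations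
-- (+, -, ×); reading an input or using the constants 0, 1 is free.

data Operand (n k : ℕ) : Set where
  entry : Fin n → Fin n → Operand n k
  reg   : Fin k → Operand n k
  zeroC : Operand n k
  oneC  : Operand n k

data Op : Set where
  plus minus times : Op

record Instr (n k : ℕ) : Set where
  constructor instr
  field
    op    : Op
    left  : Operand n k
    right : Operand n k

-- SLP n k : a program with k instructions; instruction i may use registers < i
data SLP (n : ℕ) : ℕ → Set where
  done : SLP n 0
  _▷_  : ∀ {k} → SLP n k → Instr n k → SLP n (suc k)

record Program (n : ℕ) : Set where
  field
    cost   : ℕ
    body   : SLP n cost
    output : Operand n cost

-- Column-support pattern and its column graph G^X.
-- S a = X(a) ⊆ X  (rows A = Fin n, columns X = Fin n)

ColumnEdge : ∀ {n} → (Fin n → Subset n) → Fin n → Fin n → Set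
ColumnEdge {n} S x y = x ≢ y × ∃[ a ] (x ∈ S a × y ∈ S a)

-- Rooted trees: nodes Fin (suc size), node zero is the root, node (suc i)
-- has parent (parent i), whose index is smaller (every rooted tree admits
-- such a labelling).

record RootedTree : Set where
  field
    size      : ℕ
    parent    : Fin size → Fin (suc size)
    parent-lt : ∀ i → toℕ (parent i) ≤ toℕ i

  Node : Set
  Node = Fin (suc size)

  numNodes : ℕ
  numNodes = suc size

  data Adj : Node → Node → Set where
    up   : ∀ i → Adj (suc i) (parent i)
    down : ∀ i → Adj (parent i) (suc i)

  data ConnectedIn (P : Node → Set) : Node → Node → Set where
    here : ∀ {u} → P u → ConnectedIn P u u
    step : ∀ {u v w} → P u → Adj u v → ConnectedIn P v w → ConnectedIn P u w

open RootedTree public using (Node; numNodes; ConnectedIn)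

record IsTreeDecomposition {n : ℕ} (E : Fin n → Fin n → Set)
         (T : RootedTree) (χ : Node T → Subset n) : Set where
  field
    covers  : ∀ x → ∃[ t ] (x ∈ χ t)
    edges   : ∀ x y → E x y → ∃[ t ] (x ∈ χ t × y ∈ χ t)
    subtree : ∀ x t t′ → x ∈ χ t → x ∈ χ t′ →
              ConnectedIn T (λ s → x ∈ χ s) t t′

HasWidth : ∀ {n} (T : RootedTree) → (Node T → Subset n) → ℕ → Set
HasWidth T χ ω = (∀ t → ∣ χ t ∣ ≤ suc ω) × ∃[ t ] (∣ χ t ∣ ≡ suc ω)

allVecs : (m n : ℕ) → List (Vec (Fin n) m)
allVecs zero    n = [ [] ]
allVecs (suc m) n = concatMap (λ i → map (i ∷_) (allVecs m n)) (allFin n)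

isBijectionᵇ : ∀ {n} → Vec (Fin n) n → Bool
isBijectionᵇ {n} σ =
  all (λ i → all (λ j → not ⌊ lookup σ i ≟ lookup σ j ⌋ ∨ ⌊ i ≟ j ⌋) (allFin n)) (allFin n)
  ∧ all (λ x → any (λ a → ⌊ lookup σ a ≟ x ⌋) (allFin n)) (allFin n)

bijections : (n : ℕ) → List (Vec (Fin n) n)
bijections n = filterᵇ isBijectionᵇ (allVecs n n)

module OverRing {c ℓ : Level} (R : CommutativeRing c ℓ) where
  open CommutativeRing R

  Matrix : ℕ → Set c
  Matrix n = Fin n → Fin n → Carrier

  Perm : ∀ {n} → Matrix n → Carrier
  Perm {n} M = foldr (λ σ acc → foldr (λ a p → M a (lookup σ a) * p) 1# (allFin n) + acc)
                     0# (bijections n)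

  HasSupport : ∀ {n} → Matrix n → (Fin n → Subset n) → Set ℓ
  HasSupport {n} M S = ∀ a x → (x ∈ S a → ¬ (M a x ≈ 0#)) × (x ∉ S a → M a x ≈ 0#)

  applyOp : Op → Carrier → Carrier → Carrier
  applyOp plus  u v = u + v
  applyOp minus u v = u - v
  applyOp times u v = u * v

  evalOperand : ∀ {n k} → Matrix n → Vec Carrier k → Operand n k → Carrier
  evalOperand M rs (entry a x) = M a x
  evalOperand M rs (reg i)     = lookup rs i
  evalOperand M rs zeroC       = 0#
  evalOperand M rs oneC        = 1#

  run : ∀ {n k} → Matrix n → SLP n k → Vec Carrier k
  run M done = []
  run M (P ▷ instr o l r) =
    let rs = run M P in rs ∷ʳ applyOp o (evalOperand M rs l) (evalOperand M rs r)

  evalProgram : ∀ {n} → Program n → Matrix n → Carrier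
  evalProgram P M = evalOperand M (run M (Program.body P)) (Program.output P)

module Submission where

-- Ryser's formula Perm M = Σ_{Y ⊆ X} (-1)^(n-|Y|) Π_a L_a(Y), L_a(Y) = Σ_{x ∈ Y ∩ X(a)} M a x,
-- is proved first (Ryser).  The sum over Y is then evaluated by variable elimination:
-- `eliminate` trades the summation over a column x for the finite difference Δₓ of
-- the product of the factors depending on x, stored as a table over the union of
-- their scopes minus x (Elimination, Correctness).  Columns are eliminated by
-- decreasing index of their top bag; `top-of-later-column` (TopBag) keeps each new
-- scope inside one bag, so tables have ≤ 2^(ω+1) entries, and an amortised budget
-- bounds the total cost (Complexity).

open import Level using (Level)
open import Algebra.Bundles using (CommutativeRing)
open import Data.Nat using (ℕ; zero; suc; _≤_; _<_; _<?_; _≤?_; s≤s; z≤n) renaming (_≟_ to _≟ℕ_)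
open import Data.Nat.Properties
  using (≤-refl; ≤-trans; ≤-reflexive; ≤-antisym; ≤-pred; ≰⇒>; n≤1+n; m≤n+m; m≤m+n; 1+n≰n;
         <-irrefl; <-≤-trans; ≤∧≢⇒<; +-suc; m^n>0;
         +-mono-≤; +-monoˡ-≤; +-monoʳ-≤; *-mono-≤; *-monoˡ-≤; *-monoʳ-≤; ^-monoˡ-≤; ^-monoʳ-≤;
         module ≤-Reasoning)
open import Data.Nat.Solver using (module +-*-Solver)
open import Data.Fin using (Fin; zero; suc; toℕ; fromℕ<; inject; punchIn; punchOut; _≟_)
open import Data.Fin.Properties
  using (toℕ-injective; toℕ-inject; toℕ-fromℕ<; toℕ<n; ¬∀⟶∃¬-smallest; injective⇒≤; punchIn-punchOut)
open import Data.Fin.Subset using (Subset; _∈_; _∉_; _∩_; _∪_; ∣_∣)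
open import Data.Fin.Subset.Properties using (_∈?_; ∣p∩q∣≤∣q∣; ∩-zeroˡ; ∣⊥∣≡0; p⊆q⇒∣p∣≤∣q∣; ∣p∣≤n)
open import Data.Bool using (Bool; true; false; if_then_else_; _∧_; _∨_; not)
open import Data.Bool.Properties using (∧-zeroʳ; ∨-zeroʳ)
open import Data.Bool.ListAction using (all; any)
open import Data.Vec using (Vec; []; _∷_; lookup; replicate; _[_]≔_; _∷ʳ_)
open import Data.Vec.Properties
  using (lookup-replicate; lookup-zipWith; lookup∘update; lookup∘update′; []=⇒lookup; lookup⇒[]=)
open import Data.List using (List; []; _∷_; _++_; length; map; concatMap; tabulate; foldr; filterᵇ; allFin)
open import Data.List.Properties using (length-map; length-tabulate)
open import Data.List.Relation.Unary.All as All using (All; []; _∷_)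
open import Data.List.Relation.Unary.Any using (here; there)
open import Data.List.Membership.Propositional using () renaming (_∈_ to _∈L_)
open import Data.List.Membership.Propositional.Properties using (∈-allFin)
open import Data.Product using (Σ; ∃; ∃-syntax; _,_; proj₁; proj₂; _×_)
open import Data.Sum using (_⊎_; inj₁; inj₂)
open import Data.Unit using (⊤; tt)
open import Function using (_∘_; id)
open import Relation.Nullary using (¬_; yes; no; contradiction)
open import Relation.Nullary.Decidable using (⌊_⌋; ¬?)
open import Relation.Binary.PropositionalEquality as ≡ using (_≡_; _≢_)
open import Defs

module Sums {c ℓ : Level} (R : CommutativeRing c ℓ) where
  open CommutativeRing R hiding (zero)
  open import Algebra.Properties.Semiring.Sum semiring public
    using (sum; sum-cong-≋; sum-cong-≗; *-distribʳ-sum)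
  open import Algebra.Properties.CommutativeMonoid.Sum *-commutativeMonoid public
    using () renaming (sum to prod; sum-cong-≋ to prod-cong; ∑-distrib-+ to prod-distrib-*)
  open import Algebra.Solver.CommutativeMonoid +-commutativeMonoid using (solve; _⊕_; _⊜_)

  sumL : {A : Set} → List A → (A → Carrier) → Carrier
  sumL []       f = 0#
  sumL (x ∷ xs) f = f x + sumL xs f

  sumL-cong : {A : Set} (xs : List A) {f g : A → Carrier} →
              (∀ x → f x ≈ g x) → sumL xs f ≈ sumL xs g
  sumL-cong []       f≈g = refl
  sumL-cong (x ∷ xs) f≈g = +-cong (f≈g x) (sumL-cong xs f≈g)

  sumL-++ : {A : Set} (xs ys : List A) (f : A → Carrier) →
            sumL (xs ++ ys) f ≈ sumL xs f + sumL ys f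
  sumL-++ []       ys f = sym (+-identityˡ _)
  sumL-++ (x ∷ xs) ys f = trans (+-congˡ (sumL-++ xs ys f)) (sym (+-assoc _ _ _))

  sumL-map : {A B : Set} (g : A → B) (xs : List A) (f : B → Carrier) →
             sumL (map g xs) f ≡ sumL xs (f ∘ g)
  sumL-map g []       f = ≡.refl
  sumL-map g (x ∷ xs) f = ≡.cong (f (g x) +_) (sumL-map g xs f)

  sumL-concatMap : {A B : Set} (g : A → List B) (xs : List A) (f : B → Carrier) →
                   sumL (concatMap g xs) f ≈ sumL xs (λ x → sumL (g x) f)
  sumL-concatMap g []       f = refl
  sumL-concatMap g (x ∷ xs) f =
    trans (sumL-++ (g x) (concatMap g xs) f) (+-congˡ (sumL-concatMap g xs f))

  sumL-tabulate : ∀ n {A : Set} (h : Fin n → A) (f : A → Carrier) → sumL (tabulate h) f ≡ sum (f ∘ h)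
  sumL-tabulate zero    h f = ≡.refl
  sumL-tabulate (suc n) h f = ≡.cong (f (h zero) +_) (sumL-tabulate n (h ∘ suc) f)

  *-distribˡ-sumL : {A : Set} (a : Carrier) (xs : List A) (f : A → Carrier) →
                    a * sumL xs f ≈ sumL xs (λ x → a * f x)
  *-distribˡ-sumL a []       f = zeroʳ a
  *-distribˡ-sumL a (x ∷ xs) f = trans (distribˡ a _ _) (+-congˡ (*-distribˡ-sumL a xs f))

  sumL-distrib-+ : {A : Set} (xs : List A) (f g : A → Carrier) →
                   sumL xs (λ x → f x + g x) ≈ sumL xs f + sumL xs g
  sumL-distrib-+ []       f g = sym (+-identityˡ _)
  sumL-distrib-+ (x ∷ xs) f g = trans (+-congˡ (sumL-distrib-+ xs f g))
    (solve 4 (λ a b c d → (a ⊕ b) ⊕ (c ⊕ d) ⊜ (a ⊕ c) ⊕ (b ⊕ d)) refl (f x) (g x) (sumL xs f) (sumL xs g))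

  sumY : (n : ℕ) → (Vec Bool n → Carrier) → Carrier
  sumY zero    F = F []
  sumY (suc n) F = sumY n (λ Y → F (true ∷ Y)) + sumY n (λ Y → F (false ∷ Y))

  sumY-cong : ∀ n {F G : Vec Bool n → Carrier} → (∀ Y → F Y ≈ G Y) → sumY n F ≈ sumY n G
  sumY-cong zero    F≈G = F≈G []
  sumY-cong (suc n) F≈G = +-cong (sumY-cong n (F≈G ∘ (true ∷_))) (sumY-cong n (F≈G ∘ (false ∷_)))

  sumY-distrib-+ : ∀ n (F G : Vec Bool n → Carrier) →
                   sumY n (λ Y → F Y + G Y) ≈ sumY n F + sumY n G
  sumY-distrib-+ zero    F G = refl
  sumY-distrib-+ (suc n) F G = trans
    (+-cong (sumY-distrib-+ n (F ∘ (true ∷_)) (G ∘ (true ∷_))) (sumY-distrib-+ n (F ∘ (false ∷_)) (G ∘ (false ∷_))))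
    (solve 4 (λ a b c d → (a ⊕ b) ⊕ (c ⊕ d) ⊜ (a ⊕ c) ⊕ (b ⊕ d)) refl _ _ _ _)

  *-distribˡ-sumY : ∀ n (a : Carrier) (F : Vec Bool n → Carrier) → a * sumY n F ≈ sumY n (λ Y → a * F Y)
  *-distribˡ-sumY zero    a F = refl
  *-distribˡ-sumY (suc n) a F = trans (distribˡ a _ _) (+-cong (*-distribˡ-sumY n a _) (*-distribˡ-sumY n a _))

  *-distribʳ-sumY : ∀ n (a : Carrier) (F : Vec Bool n → Carrier) → sumY n F * a ≈ sumY n (λ Y → F Y * a)
  *-distribʳ-sumY n a F =
    trans (*-comm _ a) (trans (*-distribˡ-sumY n a F) (sumY-cong n (λ Y → *-comm a (F Y))))

  sumY-sumL : ∀ n {A : Set} (xs : List A) (F : Vec Bool n → A → Carrier) →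
              sumY n (λ Y → sumL xs (F Y)) ≈ sumL xs (λ x → sumY n (λ Y → F Y x))
  sumY-sumL zero    xs F = refl
  sumY-sumL (suc n) xs F = trans
    (+-cong (sumY-sumL n xs (F ∘ (true ∷_))) (sumY-sumL n xs (F ∘ (false ∷_))))
    (sym (sumL-distrib-+ xs _ _))

-- For E, Y ⊆ Fin n, W E Y = Π_z weight (z ∈ E) (z ∈ Y): a live
-- coordinate (z ∉ E) carries Ryser's sign, an eliminated one (z ∈ E) forces z ∉ Y.
-- So W ∅ Y = (-1)^(n-|Y|), and once every coordinate is eliminated the signed sum
-- collapses to the single term Y = ∅.
module SignedSums {c ℓ : Level} (R : CommutativeRing c ℓ) where
  open CommutativeRing R hiding (zero)
  open import Algebra.Properties.Ring ring using (-1*x≈-x; -‿distribˡ-*; x[y-z]≈xy-xz)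
  open import Relation.Binary.Reasoning.Setoid setoid
  open Sums R

  weight : Bool → Bool → Carrier
  weight true  y = if y then 0# else 1#
  weight false y = if y then 1# else - 1#

  W : ∀ {n} → Vec Bool n → Vec Bool n → Carrier
  W E Y = prod (λ z → weight (lookup E z) (lookup Y z))

  Δ : ∀ {n} → Fin n → (Vec Bool n → Carrier) → Vec Bool n → Carrier
  Δ x G Y = G (Y [ x ]≔ true) - G (Y [ x ]≔ false)

  private
    sumY-scale : ∀ n a (F G : Vec Bool n → Carrier) →
                 sumY n (λ Y → (a * F Y) * G Y) ≈ a * sumY n (λ Y → F Y * G Y)
    sumY-scale n a F G = trans (sumY-cong n (λ Y → *-assoc a (F Y) (G Y))) (sym (*-distribˡ-sumY n a _))

    live-to-eliminated : ∀ w a b → (1# * w) * a + (- 1# * w) * b ≈ (0# * w) * (a - b) + (1# * w) * (a - b)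
    live-to-eliminated w a b = begin
      (1# * w) * a + (- 1# * w) * b
        ≈⟨ +-cong (*-congʳ (*-identityˡ w)) (trans (*-congʳ (-1*x≈-x w)) (sym (-‿distribˡ-* w b))) ⟩
      w * a - w * b
        ≈⟨ sym (x[y-z]≈xy-xz w a b) ⟩
      w * (a - b)
        ≈⟨ sym (+-identityˡ _) ⟩
      0# + w * (a - b)
        ≈⟨ +-cong (sym (trans (*-congʳ (zeroˡ w)) (zeroˡ _))) (*-congʳ (sym (*-identityˡ w))) ⟩
      (0# * w) * (a - b) + (1# * w) * (a - b) ∎

  eliminate : ∀ n (E : Vec Bool n) x → lookup E x ≡ false → (G : Vec Bool n → Carrier) →
              sumY n (λ Y → W E Y * G Y) ≈ sumY n (λ Y → W (E [ x ]≔ true) Y * Δ x G Y)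
  eliminate (suc n) (false ∷ E) zero ≡.refl G = begin
    sumY n (λ Y → (1# * W E Y) * G (true ∷ Y)) + sumY n (λ Y → (- 1# * W E Y) * G (false ∷ Y))
      ≈⟨ sym (sumY-distrib-+ n _ _) ⟩
    sumY n (λ Y → (1# * W E Y) * G (true ∷ Y) + (- 1# * W E Y) * G (false ∷ Y))
      ≈⟨ sumY-cong n (λ Y → live-to-eliminated (W E Y) _ _) ⟩
    sumY n (λ Y → (0# * W E Y) * Δ zero G (true ∷ Y) + (1# * W E Y) * Δ zero G (false ∷ Y))
      ≈⟨ sumY-distrib-+ n _ _ ⟩
    sumY (suc n) (λ Y → W (true ∷ E) Y * Δ zero G Y) ∎
  eliminate (suc n) (e ∷ E) (suc x) ex G = +-cong (step true) (step false)
    where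
    step : ∀ b → sumY n (λ Y → (weight e b * W E Y) * G (b ∷ Y)) ≈
                 sumY n (λ Y → (weight e b * W (E [ x ]≔ true) Y) * Δ (suc x) G (b ∷ Y))
    step b = trans (sumY-scale n (weight e b) _ _)
             (trans (*-congˡ (eliminate n E x ex (G ∘ (b ∷_)))) (sym (sumY-scale n (weight e b) _ _)))

  all-eliminated : ∀ n (G : Vec Bool n → Carrier) → sumY n (λ Y → W (replicate n true) Y * G Y) ≈ G (replicate n false)
  all-eliminated zero    G = *-identityˡ (G [])
  all-eliminated (suc n) G = begin
    sumY n (λ Y → (0# * W (replicate n true) Y) * G (true ∷ Y))
      + sumY n (λ Y → (1# * W (replicate n true) Y) * G (false ∷ Y))
      ≈⟨ +-cong (trans (sumY-scale n 0# _ _) (zeroˡ _)) (trans (sumY-scale n 1# _ _) (*-identityˡ _)) ⟩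
    0# + sumY n (λ Y → W (replicate n true) Y * G (false ∷ Y))
      ≈⟨ +-identityˡ _ ⟩
    sumY n (λ Y → W (replicate n true) Y * G (false ∷ Y))
      ≈⟨ all-eliminated n (G ∘ (false ∷_)) ⟩
    G (replicate (suc n) false) ∎

  sumY-prod : ∀ n (g : Fin n → Bool → Carrier) →
              sumY n (λ Y → prod (λ x → g x (lookup Y x))) ≈ prod (λ x → g x true + g x false)
  sumY-prod zero    g = refl
  sumY-prod (suc n) g = begin
    sumY n (λ Y → g zero true * P Y) + sumY n (λ Y → g zero false * P Y)
      ≈⟨ sym (+-cong (*-distribˡ-sumY n _ P) (*-distribˡ-sumY n _ P)) ⟩
    g zero true * sumY n P + g zero false * sumY n P
      ≈⟨ sym (distribʳ _ _ _) ⟩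
    (g zero true + g zero false) * sumY n P
      ≈⟨ *-congˡ (sumY-prod n (g ∘ suc)) ⟩
    prod (λ x → g x true + g x false) ∎
    where
    P : Vec Bool n → Carrier
    P Y = prod (λ x → g (suc x) (lookup Y x))

module BijectionTest where

  allF : (n : ℕ) → (Fin n → Bool) → Bool
  allF zero    b = true
  allF (suc n) b = b zero ∧ allF n (b ∘ suc)

  anyF : (n : ℕ) → (Fin n → Bool) → Bool
  anyF zero    b = false
  anyF (suc n) b = b zero ∨ anyF n (b ∘ suc)

  allF-elim : ∀ n (b : Fin n → Bool) → allF n b ≡ true → ∀ i → b i ≡ true
  allF-elim (suc n) b all-b zero    with b zero | all-b
  ... | true | _     = ≡.refl
  allF-elim (suc n) b all-b (suc i) with b zero | all-b
  ... | true | all-b′ = allF-elim n (b ∘ suc) all-b′ i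

  allF-intro : ∀ n (b : Fin n → Bool) → (∀ i → b i ≡ true) → allF n b ≡ true
  allF-intro zero    b b≡true = ≡.refl
  allF-intro (suc n) b b≡true rewrite b≡true zero = allF-intro n (b ∘ suc) (b≡true ∘ suc)

  anyF-elim : ∀ n (b : Fin n → Bool) → anyF n b ≡ true → ∃ λ i → b i ≡ true
  anyF-elim (suc n) b any-b with b zero in b0
  ... | true  = zero , b0
  ... | false = let i , bi = anyF-elim n (b ∘ suc) any-b in suc i , bi

  anyF-intro : ∀ n (b : Fin n → Bool) i → b i ≡ true → anyF n b ≡ true
  anyF-intro (suc n) b zero    bi rewrite bi = ≡.refl
  anyF-intro (suc n) b (suc i) bi with b zero
  ... | true  = ≡.refl
  ... | false = anyF-intro n (b ∘ suc) i bi

  allF-cong : ∀ n {b b′ : Fin n → Bool} → (∀ i → b i ≡ b′ i) → allF n b ≡ allF n b′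
  allF-cong zero    b≡b′ = ≡.refl
  allF-cong (suc n) b≡b′ = ≡.cong₂ _∧_ (b≡b′ zero) (allF-cong n (b≡b′ ∘ suc))

  all-tabulate : ∀ {A : Set} n (h : Fin n → A) (p : A → Bool) → all p (tabulate h) ≡ allF n (p ∘ h)
  all-tabulate zero    h p = ≡.refl
  all-tabulate (suc n) h p = ≡.cong (p (h zero) ∧_) (all-tabulate n (h ∘ suc) p)

  any-tabulate : ∀ {A : Set} n (h : Fin n → A) (p : A → Bool) → any p (tabulate h) ≡ anyF n (p ∘ h)
  any-tabulate zero    h p = ≡.refl
  any-tabulate (suc n) h p = ≡.cong (p (h zero) ∨_) (any-tabulate n (h ∘ suc) p)

  bool-ext : ∀ {a b : Bool} → (a ≡ true → b ≡ true) → (b ≡ true → a ≡ true) → a ≡ b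
  bool-ext {false} {false} a⇒b b⇒a = ≡.refl
  bool-ext {false} {true}  a⇒b b⇒a = b⇒a ≡.refl
  bool-ext {true}  {false} a⇒b b⇒a = ≡.sym (a⇒b ≡.refl)
  bool-ext {true}  {true}  a⇒b b⇒a = ≡.refl

  ⌊≟⌋⇒≡ : ∀ {n} (a b : Fin n) → ⌊ a ≟ b ⌋ ≡ true → a ≡ b
  ⌊≟⌋⇒≡ a b eq with a ≟ b
  ... | yes a≡b = a≡b

  ⌊≟⌋-refl : ∀ {n} (a : Fin n) → ⌊ a ≟ a ⌋ ≡ true
  ⌊≟⌋-refl a with a ≟ a
  ... | yes _  = ≡.refl
  ... | no a≢a = contradiction ≡.refl a≢a

  -- A surjective endomap of Fin n is injective: if f i ≡ f j with i ≢ j, every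
  -- value is attained off i, giving an injection Fin (suc m) → Fin m.
  surjective⇒injective : ∀ {n} (f : Fin n → Fin n) → (∀ y → ∃ λ a → f a ≡ y) →
                         ∀ i j → f i ≡ f j → i ≡ j
  surjective⇒injective {suc m} f surj i j fi≡fj with i ≟ j
  ... | yes i≡j = i≡j
  ... | no  i≢j = contradiction (injective⇒≤ section-injective) 1+n≰n
    where
    preimage≢i : ∀ y → ∃ λ a → i ≢ a × f a ≡ y
    preimage≢i y with surj y
    ... | a , fa≡y with i ≟ a
    ...   | no  i≢a = a , i≢a , fa≡y
    ...   | yes i≡a = j , i≢j , ≡.trans (≡.sym fi≡fj) (≡.trans (≡.cong f i≡a) fa≡y)
    section : Fin (suc m) → Fin m
    section y = punchOut (proj₁ (proj₂ (preimage≢i y)))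
    f∘punchIn∘section : ∀ y → f (punchIn i (section y)) ≡ y
    f∘punchIn∘section y = ≡.trans (≡.cong f (punchIn-punchOut (proj₁ (proj₂ (preimage≢i y)))))
                                  (proj₂ (proj₂ (preimage≢i y)))
    section-injective : ∀ {y y′} → section y ≡ section y′ → y ≡ y′
    section-injective {y} {y′} eq = ≡.trans (≡.sym (f∘punchIn∘section y))
      (≡.trans (≡.cong (f ∘ punchIn i) eq) (f∘punchIn∘section y′))

  module _ {n : ℕ} (σ : Vec (Fin n) n) where
    hit : Fin n → Bool
    hit x = anyF n (λ a → ⌊ lookup σ a ≟ x ⌋)

    surjᵇ : Bool
    surjᵇ = all (λ x → any (λ a → ⌊ lookup σ a ≟ x ⌋) (allFin n)) (allFin n)

    injᵇ : Bool
    injᵇ = all (λ i → all (λ j → not ⌊ lookup σ i ≟ lookup σ j ⌋ ∨ ⌊ i ≟ j ⌋) (allFin n)) (allFin n)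

    surjᵇ≡allF-hit : surjᵇ ≡ allF n hit
    surjᵇ≡allF-hit = ≡.trans (all-tabulate n id _) (allF-cong n (λ x → any-tabulate n id _))

    surjᵇ⇒surjective : surjᵇ ≡ true → ∀ x → ∃ λ a → lookup σ a ≡ x
    surjᵇ⇒surjective s x =
      let a , p = anyF-elim n _ (allF-elim n hit (≡.trans (≡.sym surjᵇ≡allF-hit) s) x)
      in a , ⌊≟⌋⇒≡ _ _ p

    surjᵇ⇒injᵇ : surjᵇ ≡ true → injᵇ ≡ true
    surjᵇ⇒injᵇ s = ≡.trans (all-tabulate n id _) (allF-intro n _ λ i →
      ≡.trans (all-tabulate n id _) (allF-intro n _ λ j → pair i j))
      where
      pair : ∀ i j → (not ⌊ lookup σ i ≟ lookup σ j ⌋ ∨ ⌊ i ≟ j ⌋) ≡ true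
      pair i j with lookup σ i ≟ lookup σ j
      ... | no _    = ≡.refl
      ... | yes σi≡σj rewrite surjective⇒injective (lookup σ) (surjᵇ⇒surjective s) i j σi≡σj = ⌊≟⌋-refl j

    isBijectionᵇ≡surjᵇ : isBijectionᵇ σ ≡ surjᵇ
    isBijectionᵇ≡surjᵇ = bool-ext bij⇒surj (λ s → ≡.cong₂ _∧_ (surjᵇ⇒injᵇ s) s)
      where
      bij⇒surj : isBijectionᵇ σ ≡ true → surjᵇ ≡ true
      bij⇒surj b with injᵇ | surjᵇ
      ... | _ | true  = ≡.refl
      ... | true  | false = b
      ... | false | false = b

    image⊆-iff : ∀ (Y : Vec Bool n) →
                 allF n (λ a → lookup Y (lookup σ a)) ≡ allF n (λ x → not (hit x) ∨ lookup Y x)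
    image⊆-iff Y = bool-ext (λ e → allF-intro n _ (hit⇒in e)) (λ e → allF-intro n _ (in-image e))
      where
      hit⇒in : allF n (λ a → lookup Y (lookup σ a)) ≡ true → ∀ x → (not (hit x) ∨ lookup Y x) ≡ true
      hit⇒in e x with hit x in hx
      ... | false = ≡.refl
      ... | true with anyF-elim n _ hx
      ...   | a , q with ⌊≟⌋⇒≡ _ _ q
      ...     | ≡.refl = allF-elim n _ e a
      in-image : allF n (λ x → not (hit x) ∨ lookup Y x) ≡ true → ∀ a → lookup Y (lookup σ a) ≡ true
      in-image e a with allF-elim n _ e (lookup σ a)
                      | anyF-intro n (λ a′ → ⌊ lookup σ a′ ≟ lookup σ a ⌋) a (⌊≟⌋-refl (lookup σ a))
      ... | r | hx rewrite hx = r

-- Expanding the product of row sums gives a sum over all maps σ : A → X, and for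
-- each σ the signed sum over Y ⊇ image σ is 1 exactly when σ is surjective.
module Ryser {c ℓ : Level} (R : CommutativeRing c ℓ) where
  open CommutativeRing R hiding (zero)
  open import Relation.Binary.Reasoning.Setoid setoid
  open Sums R
  open SignedSums R
  open BijectionTest
  open OverRing R using (Perm)

  ind : Bool → Carrier
  ind b = if b then 1# else 0#

  when : Bool → Carrier → Carrier
  when b m = if b then m else 0#

  when≈ind* : ∀ b m → when b m ≈ ind b * m
  when≈ind* true  m = sym (*-identityˡ m)
  when≈ind* false m = sym (zeroˡ m)

  prod-ind : ∀ n (b : Fin n → Bool) → prod (λ i → ind (b i)) ≈ ind (allF n b)
  prod-ind zero    b = refl
  prod-ind (suc n) b with b zero
  ... | true  = trans (*-identityˡ _) (prod-ind n (b ∘ suc))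
  ... | false = zeroˡ _

  sumL-filter : ∀ {A : Set} (p : A → Bool) (h : A → Carrier) (xs : List A) →
                foldr (λ σ acc → h σ + acc) 0# (filterᵇ p xs) ≈ sumL xs (λ σ → ind (p σ) * h σ)
  sumL-filter p h []       = refl
  sumL-filter p h (x ∷ xs) with p x
  ... | true  = +-cong (sym (*-identityˡ _)) (sumL-filter p h xs)
  ... | false = trans (sumL-filter p h xs) (trans (sym (+-identityˡ _)) (+-congʳ (sym (zeroˡ _))))

  foldr-prod : ∀ n {A : Set} (h : Fin n → A) (g : A → Carrier) →
               foldr (λ a p → g a * p) 1# (tabulate h) ≡ prod (g ∘ h)
  foldr-prod zero    h g = ≡.refl
  foldr-prod (suc n) h g = ≡.cong (g (h zero) *_) (foldr-prod n (h ∘ suc) g)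

  Perm≈sumL : ∀ {n} (M : Fin n → Fin n → Carrier) →
              Perm M ≈ sumL (allVecs n n) (λ σ → ind (isBijectionᵇ σ) * prod (λ a → M a (lookup σ a)))
  Perm≈sumL {n} M = trans (sumL-filter isBijectionᵇ _ (allVecs n n))
    (sumL-cong (allVecs n n) (λ σ → *-congˡ (reflexive (foldr-prod n id (λ a → M a (lookup σ a))))))

  sumL-allVecs-suc : ∀ m n (F : Vec (Fin n) (suc m) → Carrier) →
                     sumL (allVecs (suc m) n) F ≈ sum (λ i → sumL (allVecs m n) (F ∘ (i ∷_)))
  sumL-allVecs-suc m n F = begin
    sumL (allVecs (suc m) n) F
      ≈⟨ sumL-concatMap (λ i → map (i ∷_) (allVecs m n)) (allFin n) F ⟩
    sumL (allFin n) (λ i → sumL (map (i ∷_) (allVecs m n)) F)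
      ≡⟨ sumL-tabulate n id _ ⟩
    sum (λ i → sumL (map (i ∷_) (allVecs m n)) F)
      ≡⟨ sum-cong-≗ (λ i → sumL-map (i ∷_) (allVecs m n) F) ⟩
    sum (λ i → sumL (allVecs m n) (F ∘ (i ∷_))) ∎

  prod-of-sums : ∀ m n (c : Fin m → Fin n → Carrier) →
                 prod (λ a → sum (c a)) ≈ sumL (allVecs m n) (λ σ → prod (λ a → c a (lookup σ a)))
  prod-of-sums zero    n c = sym (+-identityʳ _)
  prod-of-sums (suc m) n c = begin
    sum (c zero) * prod (λ a → sum (c (suc a)))
      ≈⟨ *-congˡ (prod-of-sums m n (c ∘ suc)) ⟩
    sum (c zero) * sumL (allVecs m n) G
      ≈⟨ *-distribʳ-sum _ (c zero) ⟩
    sum (λ i → c zero i * sumL (allVecs m n) G)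
      ≈⟨ sum-cong-≋ (λ i → *-distribˡ-sumL (c zero i) (allVecs m n) G) ⟩
    sum (λ i → sumL (allVecs m n) (λ τ → c zero i * G τ))
      ≈⟨ sym (sumL-allVecs-suc m n _) ⟩
    sumL (allVecs (suc m) n) (λ σ → prod (λ a → c a (lookup σ a))) ∎
    where
    G : Vec (Fin n) m → Carrier
    G τ = prod (λ a → c (suc a) (lookup τ a))

  -- inclusion–exclusion for one map σ: the signed count of Y ⊇ image σ
  signed-count : ∀ {n} (σ : Vec (Fin n) n) →
                 sumY n (λ Y → W (replicate n false) Y * prod (λ a → ind (lookup Y (lookup σ a)))) ≈ ind (surjᵇ σ)
  signed-count {n} σ = begin
    sumY n (λ Y → W (replicate n false) Y * prod (λ a → ind (lookup Y (lookup σ a))))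
      ≈⟨ sumY-cong n (λ Y → *-congˡ (image-indicator Y)) ⟩
    sumY n (λ Y → W (replicate n false) Y * prod (λ x → ind (not (hit σ x) ∨ lookup Y x)))
      ≈⟨ sumY-cong n (λ Y → trans (*-congʳ (prod-cong (live-weight {Y})))
                                        (sym (prod-distrib-* (λ z → weight false (lookup Y z))
                                                             (λ z → ind (not (hit σ z) ∨ lookup Y z))))) ⟩
    sumY n (λ Y → prod (λ x → g x (lookup Y x)))
      ≈⟨ sumY-prod n g ⟩
    prod (λ x → g x true + g x false)
      ≈⟨ prod-cong (λ x → g-sum (hit σ x)) ⟩
    prod (λ x → ind (hit σ x))
      ≈⟨ prod-ind n (hit σ) ⟩
    ind (allF n (hit σ))
      ≡⟨ ≡.cong ind (≡.sym (surjᵇ≡allF-hit σ)) ⟩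
    ind (surjᵇ σ) ∎
    where
    g : Fin n → Bool → Carrier
    g x y = weight false y * ind (not (hit σ x) ∨ y)
    image-indicator : ∀ Y → prod (λ a → ind (lookup Y (lookup σ a))) ≈ prod (λ x → ind (not (hit σ x) ∨ lookup Y x))
    image-indicator Y = trans (prod-ind n _) (trans (reflexive (≡.cong ind (image⊆-iff σ Y))) (sym (prod-ind n _)))
    live-weight : ∀ {Y} z → weight (lookup (replicate n false) z) (lookup Y z) ≈ weight false (lookup Y z)
    live-weight {Y} z = reflexive (≡.cong (λ e → weight e (lookup Y z)) (lookup-replicate z false))
    g-sum : ∀ h → (1# * ind (not h ∨ true)) + (- 1# * ind (not h ∨ false)) ≈ ind h
    g-sum true  = trans (+-cong (*-identityˡ _) (zeroʳ _)) (+-identityʳ _)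
    g-sum false = trans (+-congʳ (*-identityˡ _)) (trans (+-congˡ (*-identityʳ _)) (-‿inverseʳ 1#))

  ryser : ∀ {n} (M : Fin n → Fin n → Carrier) →
          Perm M ≈ sumY n (λ Y → W (replicate n false) Y * prod (λ a → sum (λ x → when (lookup Y x) (M a x))))
  ryser {n} M = sym (begin
    sumY n (λ Y → W₀ Y * prod (λ a → sum (λ x → when (lookup Y x) (M a x))))
      ≈⟨ sumY-cong n (λ Y → *-congˡ (prod-of-sums n n (λ a x → when (lookup Y x) (M a x)))) ⟩
    sumY n (λ Y → W₀ Y * sumL V (λ σ → prod (λ a → when (lookup Y (lookup σ a)) (Mσ σ a))))
      ≈⟨ sumY-cong n (λ Y → *-distribˡ-sumL _ V _) ⟩
    sumY n (λ Y → sumL V (λ σ → W₀ Y * prod (λ a → when (lookup Y (lookup σ a)) (Mσ σ a))))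
      ≈⟨ sumY-sumL n V _ ⟩
    sumL V (λ σ → sumY n (λ Y → W₀ Y * prod (λ a → when (lookup Y (lookup σ a)) (Mσ σ a))))
      ≈⟨ sumL-cong V per-map ⟩
    sumL V (λ σ → ind (isBijectionᵇ σ) * prod (Mσ σ))
      ≈⟨ sym (Perm≈sumL M) ⟩
    Perm M ∎)
    where
    V : List (Vec (Fin n) n)
    V = allVecs n n
    W₀ : Vec Bool n → Carrier
    W₀ = W (replicate n false)
    Mσ : Vec (Fin n) n → Fin n → Carrier
    Mσ σ a = M a (lookup σ a)
    per-map : ∀ σ → sumY n (λ Y → W₀ Y * prod (λ a → when (lookup Y (lookup σ a)) (Mσ σ a)))
                    ≈ ind (isBijectionᵇ σ) * prod (Mσ σ)
    per-map σ = begin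
      sumY n (λ Y → W₀ Y * prod (λ a → when (lookup Y (lookup σ a)) (Mσ σ a)))
        ≈⟨ sumY-cong n (λ Y → trans (*-congˡ (trans (prod-cong (λ a → when≈ind* (lookup Y (lookup σ a)) (Mσ σ a)))
                                            (prod-distrib-* (λ a → ind (lookup Y (lookup σ a))) (Mσ σ))))
                                     (sym (*-assoc _ _ _))) ⟩
      sumY n (λ Y → (W₀ Y * prod (λ a → ind (lookup Y (lookup σ a)))) * prod (Mσ σ))
        ≈⟨ sym (*-distribʳ-sumY n (prod (Mσ σ)) _) ⟩
      sumY n (λ Y → W₀ Y * prod (λ a → ind (lookup Y (lookup σ a)))) * prod (Mσ σ)
        ≈⟨ *-congʳ (signed-count σ) ⟩
      ind (surjᵇ σ) * prod (Mσ σ)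
        ≡⟨ ≡.cong (λ b → ind b * prod (Mσ σ)) (≡.sym (isBijectionᵇ≡surjᵇ σ)) ⟩
      ind (isBijectionᵇ σ) * prod (Mσ σ) ∎

-- Since parents have smaller indices, the bags
-- containing x form a subtree whose root top x is the bag of least index
-- containing x.
module TopBag {n : ℕ} (T : RootedTree) (χ : Node T → Subset n)
  (covers : ∀ x → ∃ λ t → x ∈ χ t)
  (subtree : ∀ x t t′ → x ∈ χ t → x ∈ χ t′ → ConnectedIn T (λ s → x ∈ χ s) t t′) where
  open RootedTree T using (size; parent; parent-lt; here; step; up; down)

  data Descendant (t : Node T) : Node T → Set where
    itself : Descendant t t
    child  : ∀ i → Descendant t (parent i) → Descendant t (suc i)

  descendant-≤ : ∀ {t u} → Descendant t u → toℕ t ≤ toℕ u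
  descendant-≤ itself      = ≤-refl
  descendant-≤ (child i d) = ≤-trans (descendant-≤ d) (≤-trans (parent-lt i) (n≤1+n _))

  startP : ∀ {P : Node T → Set} {u w} → ConnectedIn T P u w → P u
  startP (here p)     = p
  startP (step p _ _) = p

  ParentOutside : (Node T → Set) → Node T → Set
  ParentOutside P zero    = ⊤
  ParentOutside P (suc i) = ¬ P (parent i)

  stays-below : ∀ {P : Node T → Set} {t u w} → ConnectedIn T P u w → Descendant t u →
                ParentOutside P t → Descendant t w
  stays-below (here _)                 d             out = d
  stays-below (step _ (up i) rest)     itself        out = contradiction (startP rest) out
  stays-below (step _ (up i) rest)     (child .i d)  out = stays-below rest d out
  stays-below (step _ (down i) rest)   d             out = stays-below rest (child i d) out

  enters-at : ∀ {P : Node T → Set} {t u w} → ConnectedIn T P u w → Descendant t w → P t ⊎ Descendant t u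
  enters-at (here _) d = inj₂ d
  enters-at (step _ (up i) rest) d with enters-at rest d
  ... | inj₁ pt = inj₁ pt
  ... | inj₂ dv = inj₂ (child i dv)
  enters-at (step _ (down i) rest) d with enters-at rest d
  ... | inj₁ pt            = inj₁ pt
  ... | inj₂ itself        = inj₁ (startP rest)
  ... | inj₂ (child .i d′) = inj₂ d′

  ancestors-chain : ∀ {a b s} → Descendant a s → Descendant b s → toℕ a ≤ toℕ b → Descendant a b
  ancestors-chain da itself le = da
  ancestors-chain itself (child i db) le with toℕ-injective (≤-antisym le (descendant-≤ (child i db)))
  ... | ≡.refl = itself
  ancestors-chain (child .i da) (child i db) le = ancestors-chain da db le

  least⇒ParentOutside : ∀ {P : Node T → Set} t → (∀ u → P u → toℕ t ≤ toℕ u) → ParentOutside P t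
  least⇒ParentOutside zero    least = tt
  least⇒ParentOutside (suc i) least p = <-irrefl ≡.refl (≤-trans (least _ p) (parent-lt i))

  least-bag : ∀ x → Σ (Node T) (λ t → x ∈ χ t × (∀ u → x ∈ χ u → toℕ t ≤ toℕ u))
  least-bag x with ¬∀⟶∃¬-smallest (suc size) (λ t → x ∉ χ t) (λ t → ¬? (x ∈? χ t))
                     (λ none → none (proj₁ (covers x)) (proj₂ (covers x)))
  ... | i , ¬x∉χi , earlier = i , x∈χi , least
    where
    x∈χi : x ∈ χ i
    x∈χi with x ∈? χ i
    ... | yes p = p
    ... | no q  = contradiction q ¬x∉χi
    least : ∀ u → x ∈ χ u → toℕ i ≤ toℕ u
    least u x∈χu with toℕ i ≤? toℕ u
    ... | yes le = le
    ... | no nle = contradiction (≡.subst (λ v → x ∈ χ v) (≡.sym inject-j≡u) x∈χu) (earlier j)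
      where
      j : Fin (toℕ i)
      j = fromℕ< (≰⇒> nle)
      inject-j≡u : inject j ≡ u
      inject-j≡u = toℕ-injective (≡.trans (toℕ-inject j) (toℕ-fromℕ< (≰⇒> nle)))

  top : Fin n → Node T
  top x = proj₁ (least-bag x)

  top-∈ : ∀ x → x ∈ χ (top x)
  top-∈ x = proj₁ (proj₂ (least-bag x))

  below-top : ∀ x s → x ∈ χ s → Descendant (top x) s
  below-top x s x∈χs = stays-below (subtree x (top x) s (top-∈ x) x∈χs) itself
                                   (least⇒ParentOutside (top x) (proj₂ (proj₂ (least-bag x))))

  -- x, z share the bag s and top z is no later than top x: then z ∈ χ (top x),
  -- because the path from top z down to s inside z's subtree passes through top x
  top-of-later-column : ∀ x z s → x ∈ χ s → z ∈ χ s → toℕ (top z) ≤ toℕ (top x) → z ∈ χ (top x)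
  top-of-later-column x z s x∈χs z∈χs le
    with enters-at (subtree z (top z) s (top-∈ z) z∈χs) (below-top x s x∈χs)
  ... | inj₁ z∈χtopx = z∈χtopx
  ... | inj₂ d = ≡.subst (λ v → z ∈ χ v) (≡.sym topx≡topz) (top-∈ z)
    where
    topx≡topz : top x ≡ top z
    topx≡topz = toℕ-injective (≤-antisym (descendant-≤ d)
                  (descendant-≤ (ancestors-chain (below-top z s z∈χs) (below-top x s x∈χs) le)))

-- Straight-line code is generated as a list of instructions, newest first, whose
-- operands name registers by plain numbers; toProgram turns it into a Program.
module Code where
  open import Data.Nat using (_+_; _*_; _^_)
  open import Data.Nat.Properties using (+-identityʳ)

  data Arg (n : ℕ) : Set where
    entryA      : Fin n → Fin n → Arg n
    regA        : ℕ → Arg n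
    zeroA oneA  : Arg n

  record Ins (n : ℕ) : Set where
    constructor ins
    field
      op          : Op
      left right  : Arg n

  Code : ℕ → Set
  Code n = List (Ins n)

  -- register numbers out of range never occur in generated code; they are read as 0
  toOperand : ∀ {n} k → Arg n → Operand n k
  toOperand k (entryA a x) = entry a x
  toOperand k (regA i) with i <? k
  ... | yes i<k = reg (fromℕ< i<k)
  ... | no  _   = zeroC
  toOperand k zeroA = zeroC
  toOperand k oneA  = oneC

  toSLP : ∀ {n} (p : Code n) → SLP n (length p)
  toSLP []              = done
  toSLP (ins o l r ∷ p) = toSLP p ▷ instr o (toOperand (length p) l) (toOperand (length p) r)

  toProgram : ∀ {n} → Code n → Arg n → Program n
  toProgram p o = record { cost = length p ; body = toSLP p ; output = toOperand (length p) o }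

  data Extends {n} (p : Code n) : Code n → Set where
    ext-refl : Extends p p
    ext-snoc : ∀ {q} → Extends p q → ∀ I → Extends p (I ∷ q)

  ext-trans : ∀ {n} {p q r : Code n} → Extends p q → Extends q r → Extends p r
  ext-trans e ext-refl         = e
  ext-trans e (ext-snoc e′ I) = ext-snoc (ext-trans e e′) I

  ext-length : ∀ {n} {p q : Code n} → Extends p q → length p ≤ length q
  ext-length ext-refl       = ≤-refl
  ext-length (ext-snoc e I) = ≤-trans (ext-length e) (n≤1+n _)

  Valid : ∀ {n} → ℕ → Arg n → Set
  Valid k (regA i) = i < k
  Valid k _        = ⊤

  valid-mono : ∀ {n} {k k′} (o : Arg n) → k ≤ k′ → Valid k o → Valid k′ o
  valid-mono (entryA _ _) le v = v
  valid-mono (regA i)     le v = ≤-trans v le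
  valid-mono zeroA        le v = v
  valid-mono oneA         le v = v

  Gen : ℕ → Set → Set
  Gen n A = Code n → Code n × A

  emit : ∀ {n} → Op → Arg n → Arg n → Gen n (Arg n)
  emit o l r p = ins o l r ∷ p , regA (length p)

  -- a table indexed by the subsets of a scope Z ⊆ Fin m (a trie over Z)
  data Table (A : Set) : (m : ℕ) → Subset m → Set where
    leaf   : A → Table A 0 []
    branch : ∀ {m Z} → Table A m Z → Table A m Z → Table A (suc m) (true ∷ Z)
    skip   : ∀ {m Z} → Table A m Z → Table A (suc m) (false ∷ Z)

  -- entry of the table at U ∩ Z
  lookupT : ∀ {A m Z} → Table A m Z → Subset m → A
  lookupT (leaf a)     []          = a
  lookupT (branch t f) (true ∷ U)  = lookupT t U
  lookupT (branch t f) (false ∷ U) = lookupT f U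
  lookupT (skip t)     (_ ∷ U)     = lookupT t U

  rowSum : ∀ {n m} → Fin n → Subset m → (Fin m → Fin n) → Arg n → Gen n (Arg n)
  rowSum a []          emb acc p = p , acc
  rowSum a (true ∷ V)  emb acc p = rowSum a V (emb ∘ suc) (regA (length p)) (ins plus acc (entryA a (emb zero)) ∷ p)
  rowSum a (false ∷ V) emb acc p = rowSum a V (emb ∘ suc) acc p

  tabulateT : ∀ {n m} (Z : Subset m) → (Subset m → Gen n (Arg n)) → Gen n (Table (Arg n) m Z)
  tabulateT []          e p = let p′ , o = e [] p in p′ , leaf o
  tabulateT (true ∷ Z)  e p =
    let p₁ , tₜ = tabulateT Z (e ∘ (true ∷_)) p
        p₂ , tf = tabulateT Z (e ∘ (false ∷_)) p₁
    in p₂ , branch tₜ tf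
  tabulateT (false ∷ Z) e p = let p′ , t = tabulateT Z (e ∘ (false ∷_)) p in p′ , skip t

  rowSum-cost : ∀ {n m} a (V : Subset m) emb acc (p : Code n) →
                length (proj₁ (rowSum a V emb acc p)) ≡ ∣ V ∣ + length p
  rowSum-cost a []          emb acc p = ≡.refl
  rowSum-cost a (true ∷ V)  emb acc p = ≡.trans (rowSum-cost a V _ _ _) (+-suc _ _)
  rowSum-cost a (false ∷ V) emb acc p = rowSum-cost a V _ _ _

  tabulateT-cost : ∀ {n m} (Z : Subset m) (e : Subset m → Gen n (Arg n)) k →
                   (∀ U (p : Code n) → length (proj₁ (e U p)) ≤ k + length p) →
                   ∀ (p : Code n) → length (proj₁ (tabulateT Z e p)) ≤ 2 ^ ∣ Z ∣ * k + length p
  tabulateT-cost [] e k e-cost p = ≤-trans (e-cost [] p) (≤-reflexive (≡.cong (_+ length p) (≡.sym (+-identityʳ k))))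
  tabulateT-cost (true ∷ Z) e k e-cost p = begin
    length (proj₁ (tabulateT Z (e ∘ (false ∷_)) (proj₁ (tabulateT Z (e ∘ (true ∷_)) p))))
      ≤⟨ tabulateT-cost Z _ k (e-cost ∘ (false ∷_)) _ ⟩
    2 ^ ∣ Z ∣ * k + length (proj₁ (tabulateT Z (e ∘ (true ∷_)) p))
      ≤⟨ +-monoʳ-≤ (2 ^ ∣ Z ∣ * k) (tabulateT-cost Z _ k (e-cost ∘ (true ∷_)) p) ⟩
    2 ^ ∣ Z ∣ * k + (2 ^ ∣ Z ∣ * k + length p)
      ≡⟨ solve 3 (λ a b c → a :* b :+ (a :* b :+ c) := (con 2 :* a) :* b :+ c) ≡.refl (2 ^ ∣ Z ∣) k (length p) ⟩
    2 ^ ∣ true ∷ Z ∣ * k + length p ∎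
    where
    open ≤-Reasoning
    open +-*-Solver
  tabulateT-cost (false ∷ Z) e k e-cost p = tabulateT-cost Z _ k (e-cost ∘ (false ∷_)) p

module CodeSemantics {c ℓ : Level} (R : CommutativeRing c ℓ) {n : ℕ}
                     (M : Fin n → Fin n → CommutativeRing.Carrier R) where
  open CommutativeRing R hiding (zero)
  open OverRing R using (evalOperand; run; applyOp; evalProgram)
  open Sums R using (sum)
  open Ryser R using (when)
  open Code

  readReg : ∀ {k} → Vec Carrier k → ℕ → Carrier
  readReg []      i       = 0#
  readReg (x ∷ v) zero    = x
  readReg (x ∷ v) (suc i) = readReg v i

  evalArg : ∀ {k} → Vec Carrier k → Arg n → Carrier
  evalArg v (entryA a x) = M a x
  evalArg v (regA i)     = readReg v i
  evalArg v zeroA        = 0#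
  evalArg v oneA         = 1#

  readReg-fromℕ< : ∀ {k} (v : Vec Carrier k) i (i<k : i < k) → lookup v (fromℕ< i<k) ≡ readReg v i
  readReg-fromℕ< (x ∷ v) zero    i<k       = ≡.refl
  readReg-fromℕ< (x ∷ v) (suc i) (s≤s i<k) = readReg-fromℕ< v i i<k

  readReg-out : ∀ {k} (v : Vec Carrier k) i → ¬ i < k → readReg v i ≡ 0#
  readReg-out []      i       i≮k = ≡.refl
  readReg-out (x ∷ v) zero    i≮k = contradiction (s≤s z≤n) i≮k
  readReg-out (x ∷ v) (suc i) i≮k = readReg-out v i (i≮k ∘ s≤s)

  readReg-snoc : ∀ {k} (v : Vec Carrier k) y i → i < k → readReg (v ∷ʳ y) i ≡ readReg v i
  readReg-snoc (x ∷ v) y zero    i<k       = ≡.refl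
  readReg-snoc (x ∷ v) y (suc i) (s≤s i<k) = readReg-snoc v y i i<k

  readReg-last : ∀ {k} (v : Vec Carrier k) y → readReg (v ∷ʳ y) k ≡ y
  readReg-last []      y = ≡.refl
  readReg-last (x ∷ v) y = readReg-last v y

  toOperand-correct : ∀ {k} (v : Vec Carrier k) (o : Arg n) → evalOperand M v (toOperand k o) ≡ evalArg v o
  toOperand-correct v (entryA a x) = ≡.refl
  toOperand-correct {k} v (regA i) with i <? k
  ... | yes i<k = readReg-fromℕ< v i i<k
  ... | no  i≮k = ≡.sym (readReg-out v i i≮k)
  toOperand-correct v zeroA = ≡.refl
  toOperand-correct v oneA  = ≡.refl

  registers : (p : Code n) → Vec Carrier (length p)
  registers p = run M (toSLP p)

  val : Code n → Arg n → Carrier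
  val p o = evalArg (registers p) o

  evalProgram-toProgram : ∀ (p : Code n) o → evalProgram (toProgram p o) M ≡ val p o
  evalProgram-toProgram p o = toOperand-correct (registers p) o

  registers-snoc : ∀ op l r (p : Code n) → registers (ins op l r ∷ p) ≡ registers p ∷ʳ applyOp op (val p l) (val p r)
  registers-snoc op l r p =
    ≡.cong₂ (λ a b → registers p ∷ʳ applyOp op a b) (toOperand-correct (registers p) l) (toOperand-correct (registers p) r)

  val-snoc : ∀ (I : Ins n) (p : Code n) (o : Arg n) → Valid (length p) o → val (I ∷ p) o ≡ val p o
  val-snoc (ins op l r) p (entryA a x) v = ≡.refl
  val-snoc (ins op l r) p (regA i)     v = ≡.trans (≡.cong (λ w → readReg w i) (registers-snoc op l r p))
                                                   (readReg-snoc (registers p) _ i v)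
  val-snoc (ins op l r) p zeroA        v = ≡.refl
  val-snoc (ins op l r) p oneA         v = ≡.refl

  val-new : ∀ op l r (p : Code n) → val (ins op l r ∷ p) (regA (length p)) ≡ applyOp op (val p l) (val p r)
  val-new op l r p = ≡.trans (≡.cong (λ w → readReg w (length p)) (registers-snoc op l r p)) (readReg-last (registers p) _)

  val-ext : ∀ {p q : Code n} → Extends p q → ∀ o → Valid (length p) o → val q o ≡ val p o
  val-ext ext-refl o v = ≡.refl
  val-ext {p} (ext-snoc {q} e I) o v =
    ≡.trans (val-snoc I q o (valid-mono {k = length p} o (ext-length e) v)) (val-ext e o v)

  Good : Code n → Arg n → Carrier → Set ℓ
  Good p o v = Valid (length p) o × val p o ≈ v

  good-ext : ∀ {p q : Code n} → Extends p q → ∀ {o v} → Good p o v → Good q o v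
  good-ext e {o} (valid , eq) = valid-mono o (ext-length e) valid , trans (reflexive (val-ext e o valid)) eq

  good-new : ∀ op l r (p : Code n) {a b} → Good p l a → Good p r b →
             Good (ins op l r ∷ p) (regA (length p)) (applyOp op a b)
  good-new op l r p (_ , l≈a) (_ , r≈b) = ≤-refl , trans (reflexive (val-new op l r p)) (applyOp-cong op l≈a r≈b)
    where
    applyOp-cong : ∀ op {a a′ b b′} → a ≈ a′ → b ≈ b′ → applyOp op a b ≈ applyOp op a′ b′
    applyOp-cong plus  = +-cong
    applyOp-cong minus a≈a′ b≈b′ = +-cong a≈a′ (-‿cong b≈b′)
    applyOp-cong times = *-cong

  Produces : Code n → Gen n (Arg n) → Carrier → Set ℓ
  Produces p₀ e v = ∀ (p : Code n) → Extends p₀ p → Extends p (proj₁ (e p)) × Good (proj₁ (e p)) (proj₂ (e p)) v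

  rowSum-correct : ∀ a {m} (V : Subset m) (emb : Fin m → Fin n) acc (p : Code n) {v} → Good p acc v →
    Extends p (proj₁ (rowSum a V emb acc p)) ×
    Good (proj₁ (rowSum a V emb acc p)) (proj₂ (rowSum a V emb acc p)) (v + sum (λ j → when (lookup V j) (M a (emb j))))
  rowSum-correct a []          emb acc p (valid , eq) = ext-refl , valid , trans eq (sym (+-identityʳ _))
  rowSum-correct a (true ∷ V)  emb acc p {v} good
    with rowSum-correct a V (emb ∘ suc) (regA (length p)) (ins plus acc (entryA a (emb zero)) ∷ p)
           (good-new plus acc (entryA a (emb zero)) p good (tt , refl))
  ... | e , valid , eq = ext-trans (ext-snoc ext-refl _) e , valid , trans eq (+-assoc _ _ _)
  rowSum-correct a (false ∷ V) emb acc p good with rowSum-correct a V (emb ∘ suc) acc p good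
  ... | e , valid , eq = e , valid , trans eq (+-congˡ (sym (+-identityˡ _)))

  tabulateT-correct : ∀ (p₀ : Code n) {m} (Z : Subset m) (e : Subset m → Gen n (Arg n)) (v : Subset m → Carrier) →
    (∀ U → Produces p₀ (e U) (v U)) →
    ∀ (p : Code n) → Extends p₀ p → Extends p (proj₁ (tabulateT Z e p)) ×
      (∀ U → Good (proj₁ (tabulateT Z e p)) (lookupT (proj₂ (tabulateT Z e p)) U) (v (Z ∩ U)))
  tabulateT-correct p₀ [] e v e-ok p e₀ with e-ok [] p e₀
  ... | e₁ , good = e₁ , λ { [] → good }
  tabulateT-correct p₀ (true ∷ Z) e v e-ok p e₀
    with tabulateT-correct p₀ Z (e ∘ (true ∷_)) (v ∘ (true ∷_)) (e-ok ∘ (true ∷_)) p e₀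
  ... | eₜ , goodₜ with tabulateT-correct p₀ Z (e ∘ (false ∷_)) (v ∘ (false ∷_)) (e-ok ∘ (false ∷_))
                           (proj₁ (tabulateT Z (e ∘ (true ∷_)) p)) (ext-trans e₀ eₜ)
  ... | ef , goodf = ext-trans eₜ ef , λ { (true ∷ U) → good-ext ef (goodₜ U) ; (false ∷ U) → goodf U }
  tabulateT-correct p₀ (false ∷ Z) e v e-ok p e₀
    with tabulateT-correct p₀ Z (e ∘ (false ∷_)) (v ∘ (false ∷_)) (e-ok ∘ (false ∷_)) p e₀
  ... | ef , goodf = ef , λ { (_ ∷ U) → goodf U }

-- Ryser's sum is kept
-- as Σ_Y W(E,Y) Π_{f ∈ F} f(Y), where E is the set of eliminated columns and F a
-- list of factors, each depending only on Y ∩ scope f: initially the row sums L_a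
-- (scope S a).  Eliminating a column x replaces the factors B whose scope contains
-- x by one table over Z = ∪ scope(B) ∖ {x} holding Π_B(U ∪ {x}) - Π_B(U ∖ {x}).
module Elimination {n : ℕ} (S : Fin n → Subset n) where
  open import Data.Nat using (_+_)
  open import Data.Nat.Properties using (+-assoc)
  open Code

  data Factor : Set where
    rowF : Fin n → Factor
    tabF : (Z : Subset n) → Table (Arg n) n Z → Factor

  scope : Factor → Subset n
  scope (rowF a)   = S a
  scope (tabF Z _) = Z

  evalFactor : Factor → Subset n → Gen n (Arg n)
  evalFactor (rowF a)    U   = rowSum a (U ∩ S a) id zeroA
  evalFactor (tabF Z tb) U p = p , lookupT tb U

  productAt : List Factor → Subset n → Arg n → Gen n (Arg n)
  productAt []       U acc p = p , acc
  productAt (f ∷ fs) U acc p =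
    let p′ , o = evalFactor f U p in productAt fs U (regA (length p′)) (ins times acc o ∷ p′)

  differenceAt : Fin n → List Factor → Subset n → Gen n (Arg n)
  differenceAt x B U p =
    let p₁ , o₁ = productAt B (U [ x ]≔ true)  oneA p
        p₂ , o₂ = productAt B (U [ x ]≔ false) oneA p₁
    in emit minus o₁ o₂ p₂

  partitionOn : Fin n → List Factor → List Factor × List Factor
  partitionOn x []       = [] , []
  partitionOn x (f ∷ fs) =
    let A , B = partitionOn x fs in if lookup (scope f) x then (A , f ∷ B) else (f ∷ A , B)

  unionScope : List Factor → Subset n
  unionScope []       = replicate n false
  unionScope (f ∷ fs) = scope f ∪ unionScope fs

  record State : Set where
    constructor state
    field
      code       : Code n
      eliminated : Subset n
      factors    : List Factor

  newScope : Fin n → List Factor → Subset n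
  newScope x fs = unionScope (proj₂ (partitionOn x fs)) [ x ]≔ false

  eliminateColumn : Fin n → State → State
  eliminateColumn x (state p E fs) =
    let A , B  = partitionOn x fs
        p′ , t = tabulateT (newScope x fs) (differenceAt x B) p
    in state p′ (E [ x ]≔ true) (tabF (newScope x fs) t ∷ A)

  eliminateIfLive : Fin n → State → State
  eliminateIfLive x s = if lookup (State.eliminated s) x then s else eliminateColumn x s

  pass : (rank : Fin n → ℕ) → ℕ → List (Fin n) → State → State
  pass rank j []       s = s
  pass rank j (x ∷ xs) s = pass rank j xs (if ⌊ rank x ≟ℕ j ⌋ then eliminateIfLive x s else s)

  passes : (rank : Fin n → ℕ) → ℕ → State → State
  passes rank zero    s = s
  passes rank (suc j) s = passes rank j (pass rank j (allFin n) s)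

  initial : State
  initial = state [] (replicate n false) (map rowF (allFin n))

  finalProgram : (rank : Fin n → ℕ) → ℕ → Program n
  finalProgram rank N =
    let s = passes rank N initial
        p , o = productAt (State.factors s) (replicate n false) oneA (State.code s)
    in toProgram p o

  partition-All : ∀ {p} {P : Factor → Set p} x fs → All P fs →
                  All P (proj₁ (partitionOn x fs)) × All P (proj₂ (partitionOn x fs))
  partition-All x []       []         = [] , []
  partition-All x (f ∷ fs) (pf ∷ pfs) with lookup (scope f) x | partition-All x fs pfs
  ... | true  | pA , pB = pA , pf ∷ pB
  ... | false | pA , pB = pf ∷ pA , pB

  partition-avoids : ∀ x fs → All (λ f → lookup (scope f) x ≡ false) (proj₁ (partitionOn x fs))
  partition-avoids x []       = []
  partition-avoids x (f ∷ fs) with lookup (scope f) x in fx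
  ... | true  = partition-avoids x fs
  ... | false = fx ∷ partition-avoids x fs

  partition-contains : ∀ x fs → All (λ f → lookup (scope f) x ≡ true) (proj₂ (partitionOn x fs))
  partition-contains x []       = []
  partition-contains x (f ∷ fs) with lookup (scope f) x in fx
  ... | true  = fx ∷ partition-contains x fs
  ... | false = partition-contains x fs

  partition-length : ∀ x fs → length fs ≡ length (proj₁ (partitionOn x fs)) + length (proj₂ (partitionOn x fs))
  partition-length x []       = ≡.refl
  partition-length x (f ∷ fs) with lookup (scope f) x
  ... | true  = ≡.trans (≡.cong suc (partition-length x fs)) (≡.sym (+-suc _ _))
  ... | false = ≡.cong suc (partition-length x fs)

  unionScope-⊇ : ∀ fs → All (λ f → ∀ z → lookup (scope f) z ≡ true → lookup (unionScope fs) z ≡ true) fs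
  unionScope-⊇ []       = []
  unionScope-⊇ (f ∷ fs) = first ∷ All.map (λ {g} → weaken {g}) (unionScope-⊇ fs)
    where
    first : ∀ z → lookup (scope f) z ≡ true → lookup (unionScope (f ∷ fs)) z ≡ true
    first z fz rewrite lookup-zipWith _∨_ z (scope f) (unionScope fs) | fz = ≡.refl
    weaken : ∀ {g : Factor} → (∀ z → lookup (scope g) z ≡ true → lookup (unionScope fs) z ≡ true) →
             (∀ z → lookup (scope g) z ≡ true → lookup (unionScope (f ∷ fs)) z ≡ true)
    weaken g⊆ z gz rewrite lookup-zipWith _∨_ z (scope f) (unionScope fs) | g⊆ z gz = ∨-zeroʳ _

  unionScope-elim : ∀ {Q : Set} fs z → All (λ f → lookup (scope f) z ≡ true → Q) fs →
                    lookup (unionScope fs) z ≡ true → Q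
  unionScope-elim []       z []       zu with ≡.trans (≡.sym (lookup-replicate z false)) zu
  ... | ()
  unionScope-elim (f ∷ fs) z (h ∷ hs) zu rewrite lookup-zipWith _∨_ z (scope f) (unionScope fs) with lookup (scope f) z
  ... | true  = h ≡.refl
  ... | false = unionScope-elim fs z hs zu

  productCost : Subset n → List Factor → ℕ
  productCost U []       = 0
  productCost U (f ∷ fs) = suc (∣ U ∩ scope f ∣ + productCost U fs)

  productCostBound : List Factor → ℕ
  productCostBound []       = 0
  productCostBound (f ∷ fs) = suc (∣ scope f ∣ + productCostBound fs)

  evalFactor-cost : ∀ f U (p : Code n) → length (proj₁ (evalFactor f U p)) ≤ ∣ U ∩ scope f ∣ + length p
  evalFactor-cost (rowF a)    U p = ≤-reflexive (rowSum-cost a (U ∩ S a) id zeroA p)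
  evalFactor-cost (tabF Z tb) U p = m≤n+m _ _

  productAt-cost : ∀ fs U acc (p : Code n) → length (proj₁ (productAt fs U acc p)) ≤ productCost U fs + length p
  productAt-cost []       U acc p = ≤-refl
  productAt-cost (f ∷ fs) U acc p = begin
    length (proj₁ (productAt fs U _ (ins times acc (proj₂ (evalFactor f U p)) ∷ proj₁ (evalFactor f U p))))
      ≤⟨ productAt-cost fs U _ _ ⟩
    productCost U fs + suc (length (proj₁ (evalFactor f U p)))
      ≤⟨ +-monoʳ-≤ (productCost U fs) (s≤s (evalFactor-cost f U p)) ⟩
    productCost U fs + suc (∣ U ∩ scope f ∣ + length p)
      ≡⟨ solve 3 (λ a b c → a :+ (con 1 :+ (b :+ c)) := (con 1 :+ (b :+ a)) :+ c) ≡.refl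
                 (productCost U fs) ∣ U ∩ scope f ∣ (length p) ⟩
    suc (∣ U ∩ scope f ∣ + productCost U fs) + length p ∎
    where
    open ≤-Reasoning
    open +-*-Solver

  productCost≤bound : ∀ U fs → productCost U fs ≤ productCostBound fs
  productCost≤bound U []       = z≤n
  productCost≤bound U (f ∷ fs) = s≤s (+-mono-≤ (∣p∩q∣≤∣q∣ U (scope f)) (productCost≤bound U fs))

  productCost-∅ : ∀ fs → productCost (replicate n false) fs ≡ length fs
  productCost-∅ []       = ≡.refl
  productCost-∅ (f ∷ fs) rewrite ∩-zeroˡ (scope f) | ∣⊥∣≡0 n = ≡.cong suc (productCost-∅ fs)

  differenceAt-cost : ∀ x B U (p : Code n) →
    length (proj₁ (differenceAt x B U p)) ≤ suc (productCostBound B + productCostBound B) + length p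
  differenceAt-cost x B U p = s≤s (begin
    length (proj₁ (productAt B (U [ x ]≔ false) oneA (proj₁ (productAt B (U [ x ]≔ true) oneA p))))
      ≤⟨ productAt-cost B _ oneA _ ⟩
    productCost (U [ x ]≔ false) B + length (proj₁ (productAt B (U [ x ]≔ true) oneA p))
      ≤⟨ +-mono-≤ (productCost≤bound _ B) (productAt-cost B _ oneA p) ⟩
    productCostBound B + (productCost (U [ x ]≔ true) B + length p)
      ≤⟨ +-monoʳ-≤ (productCostBound B) (+-monoˡ-≤ (length p) (productCost≤bound _ B)) ⟩
    productCostBound B + (productCostBound B + length p)
      ≡⟨ ≡.sym (+-assoc (productCostBound B) (productCostBound B) (length p)) ⟩
    productCostBound B + productCostBound B + length p ∎)
    where open ≤-Reasoning

  module _ {a : Level} (Inv : State → Set a)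
           (preserved : ∀ x s → lookup (State.eliminated s) x ≡ false → Inv s → Inv (eliminateColumn x s)) where

    eliminateIfLive-preserves : ∀ x s → Inv s → Inv (eliminateIfLive x s)
    eliminateIfLive-preserves x (state p E fs) inv with lookup E x in Ex
    ... | true  = inv
    ... | false = preserved x (state p E fs) Ex inv

    pass-preserves : ∀ rank j xs s → Inv s → Inv (pass rank j xs s)
    pass-preserves rank j []       s inv = inv
    pass-preserves rank j (x ∷ xs) s inv with ⌊ rank x ≟ℕ j ⌋
    ... | true  = pass-preserves rank j xs (eliminateIfLive x s) (eliminateIfLive-preserves x s inv)
    ... | false = pass-preserves rank j xs s inv

    passes-preserve : ∀ rank j s → Inv s → Inv (passes rank j s)
    passes-preserve rank zero    s inv = inv
    passes-preserve rank (suc j) s inv =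
      passes-preserve rank j (pass rank j (allFin n) s) (pass-preserves rank j (allFin n) s inv)

AgreeOn : ∀ {m} → Subset m → Subset m → Subset m → Set
AgreeOn Z U U′ = ∀ z → lookup Z z ≡ true → lookup U z ≡ lookup U′ z

∩-agree : ∀ {m} (Z U U′ : Subset m) → AgreeOn Z U U′ → Z ∩ U ≡ Z ∩ U′
∩-agree []          []      []        agree = ≡.refl
∩-agree (true ∷ Z)  (u ∷ U) (u′ ∷ U′) agree = ≡.cong₂ _∷_ (agree zero ≡.refl) (∩-agree Z U U′ (agree ∘ suc))
∩-agree (false ∷ Z) (u ∷ U) (u′ ∷ U′) agree = ≡.cong (false ∷_) (∩-agree Z U U′ (agree ∘ suc))

-- Correctness of the elimination algorithm: the invariant
--   Σ_Y W(E,Y) Π_{f ∈ F} f(Y) ≈ Perm M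
-- holds initially by Ryser's formula, is preserved by each elimination (lemma
-- eliminate), and at the end, when E is everything, reduces to Π_F f(∅), which is
-- what the final program computes.
module Correctness {c ℓ : Level} (R : CommutativeRing c ℓ) {n : ℕ} (S : Fin n → Subset n)
                   (M : Fin n → Fin n → CommutativeRing.Carrier R) where
  open CommutativeRing R hiding (zero)
  open import Algebra.Properties.Ring ring using (x[y-z]≈xy-xz)
  open import Relation.Binary.Reasoning.Setoid setoid
  open Sums R
  open SignedSums R
  open Ryser R using (when; ryser)
  open Code
  open CodeSemantics R M
  open Elimination S

  L : Fin n → Subset n → Carrier
  L a U = sum (λ x → when (lookup (U ∩ S a) x) (M a x))

  factorValue : Code n → Factor → Subset n → Carrier
  factorValue p (rowF a)    U = L a U
  factorValue p (tabF Z tb) U = val p (lookupT tb U)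

  Stored : Code n → Factor → Set
  Stored p (rowF a)    = ⊤
  Stored p (tabF Z tb) = ∀ U → Valid (length p) (lookupT tb U)

  stored-ext : ∀ {p q : Code n} → Extends p q → ∀ {fs} → All (Stored p) fs → All (Stored q) fs
  stored-ext {p} {q} e = All.map (λ {f} → ext f)
    where
    ext : ∀ f → Stored p f → Stored q f
    ext (rowF a)    s   = tt
    ext (tabF Z tb) s U = valid-mono (lookupT tb U) (ext-length e) (s U)

  factorValue-ext : ∀ {p q : Code n} → Extends p q → ∀ f → Stored p f → ∀ U → factorValue q f U ≈ factorValue p f U
  factorValue-ext e (rowF a)    s U = refl
  factorValue-ext e (tabF Z tb) s U = reflexive (val-ext e (lookupT tb U) (s U))

  evalFactor-correct : ∀ (p : Code n) f U → Stored p f →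
    Extends p (proj₁ (evalFactor f U p)) × Good (proj₁ (evalFactor f U p)) (proj₂ (evalFactor f U p)) (factorValue p f U)
  evalFactor-correct p (rowF a) U s with rowSum-correct a (U ∩ S a) id zeroA p {0#} (tt , refl)
  ... | e , valid , eq = e , valid , trans eq (+-identityˡ _)
  evalFactor-correct p (tabF Z tb) U s = ext-refl , s U , refl

  productValue : Code n → List Factor → Subset n → Carrier
  productValue p []       U = 1#
  productValue p (f ∷ fs) U = factorValue p f U * productValue p fs U

  productValue-ext : ∀ {p q : Code n} → Extends p q → ∀ {fs} → All (Stored p) fs → ∀ U →
                     productValue q fs U ≈ productValue p fs U
  productValue-ext e []                 U = refl
  productValue-ext e {f ∷ fs} (s ∷ ss) U = *-cong (factorValue-ext e f s U) (productValue-ext e ss U)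

  productAt-correct : ∀ fs U acc (p : Code n) {v} → All (Stored p) fs → Good p acc v →
    Extends p (proj₁ (productAt fs U acc p)) ×
    Good (proj₁ (productAt fs U acc p)) (proj₂ (productAt fs U acc p)) (v * productValue p fs U)
  productAt-correct [] U acc p ss (valid , eq) = ext-refl , valid , trans eq (sym (*-identityʳ _))
  productAt-correct (f ∷ fs) U acc p {v} (s ∷ ss) good with evalFactor-correct p f U s
  ... | e₁ , good₁
    with productAt-correct fs U (regA (length (proj₁ (evalFactor f U p))))
           (ins times acc (proj₂ (evalFactor f U p)) ∷ proj₁ (evalFactor f U p))
           (stored-ext (ext-snoc e₁ _) ss)
           (good-new times acc (proj₂ (evalFactor f U p)) (proj₁ (evalFactor f U p)) (good-ext e₁ good) good₁)
  ... | e₂ , valid , eq = ext-trans (ext-snoc e₁ _) e₂ ,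
                          valid , trans eq (trans (*-congˡ (productValue-ext (ext-snoc e₁ _) ss U)) (*-assoc _ _ _))

  differenceAt-correct : ∀ (p₀ : Code n) x B → All (Stored p₀) B → ∀ U →
    Produces p₀ (differenceAt x B U) (Δ x (productValue p₀ B) U)
  differenceAt-correct p₀ x B ss U p p₀⊑p =
    ext-snoc (ext-trans (proj₁ first) (proj₁ second)) _ , proj₁ difference ,
    trans (proj₂ difference) (+-cong (trans (*-identityˡ _) (productValue-ext p₀⊑p ss _))
                                     (-‿cong (trans (*-identityˡ _) (productValue-ext p₀⊑p₁ ss _))))
    where
    r₁ r₂ : Code n × Arg n
    r₁ = productAt B (U [ x ]≔ true) oneA p
    r₂ = productAt B (U [ x ]≔ false) oneA (proj₁ r₁)
    first : Extends p (proj₁ r₁) × Good (proj₁ r₁) (proj₂ r₁) (1# * productValue p B (U [ x ]≔ true))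
    first = productAt-correct B (U [ x ]≔ true) oneA p (stored-ext p₀⊑p ss) (tt , refl)
    p₀⊑p₁ : Extends p₀ (proj₁ r₁)
    p₀⊑p₁ = ext-trans p₀⊑p (proj₁ first)
    second : Extends (proj₁ r₁) (proj₁ r₂) × Good (proj₁ r₂) (proj₂ r₂) (1# * productValue (proj₁ r₁) B (U [ x ]≔ false))
    second = productAt-correct B (U [ x ]≔ false) oneA (proj₁ r₁) (stored-ext p₀⊑p₁ ss) (tt , refl)
    difference : Good (proj₁ (emit minus (proj₂ r₁) (proj₂ r₂) (proj₁ r₂)))
                      (proj₂ (emit minus (proj₂ r₁) (proj₂ r₂) (proj₁ r₂)))
                      (1# * productValue p B (U [ x ]≔ true) - 1# * productValue (proj₁ r₁) B (U [ x ]≔ false))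
    difference = good-new minus (proj₂ r₁) (proj₂ r₂) (proj₁ r₂) (good-ext (proj₁ second) (proj₂ first)) (proj₂ second)

  DependsOn : Subset n → (Subset n → Carrier) → Set ℓ
  DependsOn Z g = ∀ U U′ → AgreeOn Z U U′ → g U ≈ g U′

  row-depends : ∀ (p : Code n) a → DependsOn (S a) (factorValue p (rowF a))
  row-depends p a U U′ agree = sum-cong-≋ (λ x → reflexive (≡.cong (λ b → when b (M a x)) (same x)))
    where
    same : ∀ x → lookup (U ∩ S a) x ≡ lookup (U′ ∩ S a) x
    same x rewrite lookup-zipWith _∧_ x U (S a) | lookup-zipWith _∧_ x U′ (S a) with lookup (S a) x in ax
    ... | true  = ≡.cong (_∧ true) (agree x ax)
    ... | false = ≡.trans (∧-zeroʳ _) (≡.sym (∧-zeroʳ _))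

  productValue-partition : ∀ (p : Code n) x fs U →
    productValue p fs U ≈ productValue p (proj₁ (partitionOn x fs)) U * productValue p (proj₂ (partitionOn x fs)) U
  productValue-partition p x []       U = sym (*-identityˡ _)
  productValue-partition p x (f ∷ fs) U with lookup (scope f) x
  ... | true  = trans (*-congˡ (productValue-partition p x fs U))
                  (trans (sym (*-assoc _ _ _)) (trans (*-congʳ (*-comm _ _)) (*-assoc _ _ _)))
  ... | false = trans (*-congˡ (productValue-partition p x fs U)) (sym (*-assoc _ _ _))

  productValue-cong : ∀ (p : Code n) fs U U′ → All (λ f → factorValue p f U ≈ factorValue p f U′) fs →
                      productValue p fs U ≈ productValue p fs U′
  productValue-cong p []       U U′ []         = refl
  productValue-cong p (f ∷ fs) U U′ (eq ∷ eqs) = *-cong eq (productValue-cong p fs U U′ eqs)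

  record Invariant (s : State) : Set ℓ where
    constructor invariant
    open State s
    field
      stored  : All (Stored code) factors
      depends : All (λ f → DependsOn (scope f) (factorValue code f)) factors
      sum≈    : sumY n (λ Y → W eliminated Y * productValue code factors Y) ≈ OverRing.Perm R M

  module Step (x : Fin n) (p : Code n) (fs : List Factor)
              (stored : All (Stored p) fs) (depends : All (λ f → DependsOn (scope f) (factorValue p f)) fs) where
    A B : List Factor
    A = proj₁ (partitionOn x fs)
    B = proj₂ (partitionOn x fs)

    Z′ : Subset n
    Z′ = newScope x fs

    ψ : Subset n → Carrier
    ψ = Δ x (productValue p B)

    storedA : All (Stored p) A
    storedA = proj₁ (partition-All x fs stored)

    storedB : All (Stored p) B
    storedB = proj₂ (partition-All x fs stored)

    dependsA : All (λ f → DependsOn (scope f) (factorValue p f)) A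
    dependsA = proj₁ (partition-All x fs depends)

    dependsB : All (λ f → DependsOn (scope f) (factorValue p f)) B
    dependsB = proj₂ (partition-All x fs depends)

    p′ : Code n
    p′ = proj₁ (tabulateT Z′ (differenceAt x B) p)

    table : Table (Arg n) n Z′
    table = proj₂ (tabulateT Z′ (differenceAt x B) p)

    built : Extends p p′ × (∀ U → Good p′ (lookupT table U) (ψ (Z′ ∩ U)))
    built = tabulateT-correct p Z′ (differenceAt x B) ψ (differenceAt-correct p x B storedB) p ext-refl

    p⊑p′ : Extends p p′
    p⊑p′ = proj₁ built

    entry-good : ∀ U → Good p′ (lookupT table U) (ψ (Z′ ∩ U))
    entry-good = proj₂ built

    -- the factors in B only see Z′ ∪ {x}, so ψ only sees Z′
    ψ-local : ∀ U → ψ (Z′ ∩ U) ≈ ψ U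
    ψ-local U = +-cong (productValue-cong p B _ _ (agreeB true)) (-‿cong (productValue-cong p B _ _ (agreeB false)))
      where
      agree : ∀ b f → (∀ z → lookup (scope f) z ≡ true → lookup (unionScope B) z ≡ true) →
              AgreeOn (scope f) ((Z′ ∩ U) [ x ]≔ b) (U [ x ]≔ b)
      agree b f f⊆ z fz with z ≟ x
      ... | yes ≡.refl = ≡.trans (lookup∘update z (Z′ ∩ U) b) (≡.sym (lookup∘update z U b))
      ... | no  z≢x rewrite lookup∘update′ z≢x (Z′ ∩ U) b | lookup∘update′ z≢x U b
                          | lookup-zipWith _∧_ z Z′ U
                          | lookup∘update′ z≢x (unionScope B) false | f⊆ z fz = ≡.refl
      agreeB : ∀ b → All (λ f → factorValue p f ((Z′ ∩ U) [ x ]≔ b) ≈ factorValue p f (U [ x ]≔ b)) B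
      agreeB b = All.zipWith (λ {f} (dep , f⊆) → dep _ _ (agree b f f⊆)) (dependsB , unionScope-⊇ B)

    table-value : ∀ U → factorValue p′ (tabF Z′ table) U ≈ ψ U
    table-value U = trans (proj₂ (entry-good U)) (ψ-local U)

    A-avoids-x : ∀ U b → productValue p A (U [ x ]≔ b) ≈ productValue p A U
    A-avoids-x U b = productValue-cong p A _ _
      (All.zipWith (λ {f} (dep , fx) → dep _ _ (agree f fx)) (dependsA , partition-avoids x fs))
      where
      agree : ∀ f → lookup (scope f) x ≡ false → AgreeOn (scope f) (U [ x ]≔ b) U
      agree f fx z fz with z ≟ x
      ... | yes ≡.refl with ≡.trans (≡.sym fz) fx
      ...   | ()
      agree f fx z fz | no z≢x = lookup∘update′ z≢x U b

    Δ-factorises : ∀ U → Δ x (productValue p fs) U ≈ productValue p′ (tabF Z′ table ∷ A) U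
    Δ-factorises U = begin
      productValue p fs (U [ x ]≔ true) - productValue p fs (U [ x ]≔ false)
        ≈⟨ +-cong (productValue-partition p x fs _) (-‿cong (productValue-partition p x fs _)) ⟩
      PA (U [ x ]≔ true) * PB (U [ x ]≔ true) - PA (U [ x ]≔ false) * PB (U [ x ]≔ false)
        ≈⟨ +-cong (*-congʳ (A-avoids-x U true)) (-‿cong (*-congʳ (A-avoids-x U false))) ⟩
      PA U * PB (U [ x ]≔ true) - PA U * PB (U [ x ]≔ false)
        ≈⟨ sym (x[y-z]≈xy-xz _ _ _) ⟩
      PA U * ψ U
        ≈⟨ *-comm _ _ ⟩
      ψ U * PA U
        ≈⟨ *-cong (sym (table-value U)) (sym (productValue-ext p⊑p′ storedA U)) ⟩
      productValue p′ (tabF Z′ table ∷ A) U ∎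
      where
      PA PB : Subset n → Carrier
      PA = productValue p A
      PB = productValue p B

    stored′ : All (Stored p′) (tabF Z′ table ∷ A)
    stored′ = (λ U → proj₁ (entry-good U)) ∷ stored-ext p⊑p′ storedA

    depends′ : All (λ f → DependsOn (scope f) (factorValue p′ f)) (tabF Z′ table ∷ A)
    depends′ = table-depends ∷ All.zipWith (λ {f} (s , dep) → moved f s dep) (storedA , dependsA)
      where
      table-depends : DependsOn Z′ (factorValue p′ (tabF Z′ table))
      table-depends U U′ agree = trans (proj₂ (entry-good U))
        (trans (reflexive (≡.cong ψ (∩-agree Z′ U U′ agree))) (sym (proj₂ (entry-good U′))))
      moved : ∀ f → Stored p f → DependsOn (scope f) (factorValue p f) → DependsOn (scope f) (factorValue p′ f)
      moved f s dep U U′ agree = trans (factorValue-ext p⊑p′ f s U)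
                                   (trans (dep U U′ agree) (sym (factorValue-ext p⊑p′ f s U′)))

  eliminateColumn-correct : ∀ x s → lookup (State.eliminated s) x ≡ false → Invariant s → Invariant (eliminateColumn x s)
  eliminateColumn-correct x (state p E fs) Ex (invariant stored depends sum≈) = invariant stored′ depends′ (begin
    sumY n (λ Y → W (E [ x ]≔ true) Y * productValue p′ (tabF Z′ table ∷ A) Y)
      ≈⟨ sumY-cong n (λ Y → *-congˡ (sym (Δ-factorises Y))) ⟩
    sumY n (λ Y → W (E [ x ]≔ true) Y * Δ x (productValue p fs) Y)
      ≈⟨ sym (eliminate n E x Ex (productValue p fs)) ⟩
    sumY n (λ Y → W E Y * productValue p fs Y)
      ≈⟨ sum≈ ⟩
    OverRing.Perm R M ∎)
    where open Step x p fs stored depends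

  final-correct : ∀ s → Invariant s → (∀ z → lookup (State.eliminated s) z ≡ true) →
    let r = productAt (State.factors s) (replicate n false) oneA (State.code s) in
    OverRing.evalProgram R (toProgram (proj₁ r) (proj₂ r)) M ≈ OverRing.Perm R M
  final-correct (state p E fs) (invariant stored depends sum≈) every-eliminated = begin
    OverRing.evalProgram R (toProgram (proj₁ r) (proj₂ r)) M
      ≡⟨ evalProgram-toProgram (proj₁ r) (proj₂ r) ⟩
    val (proj₁ r) (proj₂ r)
      ≈⟨ proj₂ (proj₂ (productAt-correct fs (replicate n false) oneA p {1#} stored (tt , refl))) ⟩
    1# * productValue p fs (replicate n false)
      ≈⟨ *-identityˡ _ ⟩
    productValue p fs (replicate n false)
      ≈⟨ sym (all-eliminated n (productValue p fs)) ⟩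
    sumY n (λ Y → W (replicate n true) Y * productValue p fs Y)
      ≡⟨ ≡.cong (λ E′ → sumY n (λ Y → W E′ Y * productValue p fs Y)) (≡.sym (everything E every-eliminated)) ⟩
    sumY n (λ Y → W E Y * productValue p fs Y)
      ≈⟨ sum≈ ⟩
    OverRing.Perm R M ∎
    where
    r : Code n × Arg n
    r = productAt fs (replicate n false) oneA p
    everything : ∀ {m} (E : Subset m) → (∀ z → lookup E z ≡ true) → E ≡ replicate m true
    everything []      every = ≡.refl
    everything (e ∷ E) every = ≡.cong₂ _∷_ (every zero) (everything E (every ∘ suc))

  -- Initially the invariant is Ryser's formula; here the support hypothesis enters:
  -- restricting row a to S a does not change its row sum.
  initial-correct : OverRing.HasSupport R M S → Invariant initial
  initial-correct support = invariant (rows-stored (allFin n)) (rows-depend (allFin n)) (begin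
    sumY n (λ Y → W (replicate n false) Y * productValue [] (map rowF (allFin n)) Y)
      ≈⟨ sumY-cong n (λ Y → *-congˡ (trans (reflexive (rows-product id Y)) (prod-cong (λ a → L-full a Y)))) ⟩
    sumY n (λ Y → W (replicate n false) Y * prod (λ a → sum (λ x → when (lookup Y x) (M a x))))
      ≈⟨ sym (ryser M) ⟩
    OverRing.Perm R M ∎)
    where
    rows-stored : ∀ as → All (Stored []) (map rowF as)
    rows-stored []       = []
    rows-stored (a ∷ as) = tt ∷ rows-stored as
    rows-depend : ∀ as → All (λ f → DependsOn (scope f) (factorValue [] f)) (map rowF as)
    rows-depend []       = []
    rows-depend (a ∷ as) = row-depends [] a ∷ rows-depend as
    rows-product : ∀ {m} (h : Fin m → Fin n) Y → productValue [] (map rowF (tabulate h)) Y ≡ prod (λ a → L (h a) Y)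
    rows-product {zero}  h Y = ≡.refl
    rows-product {suc m} h Y = ≡.cong (L (h zero) Y *_) (rows-product (h ∘ suc) Y)
    L-full : ∀ a Y → L a Y ≈ sum (λ x → when (lookup Y x) (M a x))
    L-full a Y = sum-cong-≋ restricted
      where
      restricted : ∀ x → when (lookup (Y ∩ S a) x) (M a x) ≈ when (lookup Y x) (M a x)
      restricted x rewrite lookup-zipWith _∧_ x Y (S a) with lookup Y x | lookup (S a) x in ax
      ... | false | _     = refl
      ... | true  | true  = refl
      ... | true  | false = sym (proj₂ (support a x) (λ x∈Sa → false≢true (≡.trans (≡.sym ax) ([]=⇒lookup x∈Sa))))
        where
        false≢true : false ≢ true
        false≢true ()

  finalProgram-correct : OverRing.HasSupport R M S → ∀ rank N →
    (∀ z → lookup (State.eliminated (passes rank N initial)) z ≡ true) →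
    OverRing.evalProgram R (finalProgram rank N) M ≈ OverRing.Perm R M
  finalProgram-correct support rank N all-done =
    final-correct (passes rank N initial)
      (passes-preserve Invariant eliminateColumn-correct rank N initial (initial-correct support)) all-done

-- Columns are eliminated by decreasing rank, so when x is eliminated every live
-- column z has top z ≤ top x; since all scopes are cliques of G^X (pairs sharing a
-- bag), every scope containing x lies in the bag χ(top x) (top-of-later-column).
-- Hence the new table has at most 2^(ω+1) entries, each costing O(ω) per factor,
-- and an amortised budget α·#factors + code ≤ α·n + β·|E| is maintained.
module Complexity {n : ℕ} (S : Fin n → Subset n) (T : RootedTree) (χ : Node T → Subset n)
                  (TD : IsTreeDecomposition (ColumnEdge S) T χ) (ω : ℕ) (HW : HasWidth T χ ω) where
  open IsTreeDecomposition TD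
  open TopBag T χ covers subtree using (top; top-∈; top-of-later-column)
  open import Data.Nat using (_+_; _*_; _^_)
  open import Data.Nat.Properties using (+-comm; *-identityˡ)
  open Code
  open Elimination S
  open +-*-Solver

  rank : Fin n → ℕ
  rank x = toℕ (top x)

  Clique : Subset n → Set
  Clique Z = ∀ y z → lookup Z y ≡ true → lookup Z z ≡ true → ∃ λ s → y ∈ χ s × z ∈ χ s

  Live : Subset n → Subset n → Set
  Live E Z = ∀ z → lookup Z z ≡ true → lookup E z ≡ false

  -- table size bound, cost per factor, and the budget constants
  K α β : ℕ
  K = 2 ^ suc ω
  α = K * (2 * suc (suc ω))
  β = α + K

  record Tracked (s : State) : Set where
    constructor tracked
    open State s
    field
      live    : All (λ f → Live eliminated (scope f)) factors
      cliques : All (λ f → Clique (scope f)) factors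
      budget  : length code + α * length factors ≤ α * n + β * ∣ eliminated ∣

  DoneFrom : ℕ → State → Set
  DoneFrom j s = ∀ z → j ≤ rank z → lookup (State.eliminated s) z ≡ true

  Grows : Subset n → Subset n → Set
  Grows E E′ = ∀ z → lookup E z ≡ true → lookup E′ z ≡ true

  true≢false : true ≢ false
  true≢false ()

  inside-bag-≤ : ∀ (Z : Subset n) t → (∀ z → lookup Z z ≡ true → z ∈ χ t) → ∣ Z ∣ ≤ suc ω
  inside-bag-≤ Z t Z⊆χt = ≤-trans (p⊆q⇒∣p∣≤∣q∣ {p = Z} {q = χ t} (λ {z} z∈Z → Z⊆χt z ([]=⇒lookup z∈Z))) (proj₁ HW t)

  productCostBound-≤ : ∀ fs → All (λ f → ∣ scope f ∣ ≤ suc ω) fs → productCostBound fs ≤ length fs * suc (suc ω)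
  productCostBound-≤ []       []         = z≤n
  productCostBound-≤ (f ∷ fs) (bf ∷ bfs) = s≤s (+-mono-≤ bf (productCostBound-≤ fs bfs))

  ∣insert∣ : ∀ {m} (E : Subset m) x → lookup E x ≡ false → ∣ E [ x ]≔ true ∣ ≡ suc ∣ E ∣
  ∣insert∣ (false ∷ E) zero    ≡.refl = ≡.refl
  ∣insert∣ (true ∷ E)  (suc x) Ex     = ≡.cong suc (∣insert∣ E x Ex)
  ∣insert∣ (false ∷ E) (suc x) Ex     = ∣insert∣ E x Ex

  module Step (j : ℕ) (x : Fin n) (p : Code n) (E : Subset n) (fs : List Factor)
              (live : All (λ f → Live E (scope f)) fs) (cliques : All (λ f → Clique (scope f)) fs)
              (done-above : DoneFrom (suc j) (state p E fs)) (rank-x : rank x ≡ j) (Ex : lookup E x ≡ false) where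
    A B : List Factor
    A = proj₁ (partitionOn x fs)
    B = proj₂ (partitionOn x fs)

    Z′ : Subset n
    Z′ = newScope x fs

    live-≤ : ∀ z → lookup E z ≡ false → rank z ≤ rank x
    live-≤ z Ez with suc j ≤? rank z
    ... | yes j<z = contradiction (≡.trans (≡.sym (done-above z j<z)) Ez) true≢false
    ... | no  j≮z = ≡.subst (rank z ≤_) (≡.sym rank-x) (≤-pred (≰⇒> j≮z))

    B-in-bag : All (λ f → ∀ z → lookup (scope f) z ≡ true → z ∈ χ (top x)) B
    B-in-bag = All.zipWith (λ {f} ((lv , cl) , fx) z fz →
                 let s , x∈χs , z∈χs = cl x z fx fz in top-of-later-column x z s x∈χs z∈χs (live-≤ z (lv z fz)))
               (All.zipWith id (proj₂ (partition-All x fs live) , proj₂ (partition-All x fs cliques)) ,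
                partition-contains x fs)

    Z′∌x : ∀ z → lookup Z′ z ≡ true → z ≢ x
    Z′∌x z Z′z ≡.refl = true≢false (≡.trans (≡.sym Z′z) (lookup∘update z (unionScope B) false))

    Z′⊆∪B : ∀ z → lookup Z′ z ≡ true → lookup (unionScope B) z ≡ true
    Z′⊆∪B z Z′z = ≡.trans (≡.sym (lookup∘update′ (Z′∌x z Z′z) (unionScope B) false)) Z′z

    Z′-in-bag : ∀ z → lookup Z′ z ≡ true → z ∈ χ (top x)
    Z′-in-bag z Z′z = unionScope-elim B z (All.map (λ h → h z) B-in-bag) (Z′⊆∪B z Z′z)

    Z′-live : Live E Z′
    Z′-live z Z′z = unionScope-elim B z (All.map (λ h → h z) (proj₂ (partition-All x fs live))) (Z′⊆∪B z Z′z)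

    E′ : Subset n
    E′ = E [ x ]≔ true

    live′ : All (λ f → Live E′ (scope f)) (tabF Z′ (proj₂ (tabulateT Z′ (differenceAt x B) p)) ∷ A)
    live′ = (λ z Z′z → ≡.trans (lookup∘update′ (Z′∌x z Z′z) E true) (Z′-live z Z′z)) ∷
            All.zipWith (λ {f} (lv , fx) z fz → ≡.trans (lookup∘update′ (z≢x f fx z fz) E true) (lv z fz))
              (proj₁ (partition-All x fs live) , partition-avoids x fs)
      where
      z≢x : ∀ f → lookup (scope f) x ≡ false → ∀ z → lookup (scope f) z ≡ true → z ≢ x
      z≢x f fx z fz ≡.refl = true≢false (≡.trans (≡.sym fz) fx)

    cliques′ : All (λ f → Clique (scope f)) (tabF Z′ (proj₂ (tabulateT Z′ (differenceAt x B) p)) ∷ A)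
    cliques′ = (λ y z Z′y Z′z → top x , Z′-in-bag y Z′y , Z′-in-bag z Z′z) ∷ proj₁ (partition-All x fs cliques)

    p′ : Code n
    p′ = proj₁ (tabulateT Z′ (differenceAt x B) p)

    -- the new table costs at most K entries of cost 1 + 2·|B|·(ω+2)
    table-cost : length p′ ≤ K + α * length B + length p
    table-cost = begin
      length p′
        ≤⟨ tabulateT-cost Z′ (differenceAt x B) (suc (c + c)) (differenceAt-cost x B) p ⟩
      2 ^ ∣ Z′ ∣ * suc (c + c) + length p
        ≤⟨ +-monoˡ-≤ (length p) (*-mono-≤ (^-monoʳ-≤ 2 (inside-bag-≤ Z′ (top x) Z′-in-bag)) (s≤s (+-mono-≤ c≤ c≤))) ⟩
      K * suc (length B * suc (suc ω) + length B * suc (suc ω)) + length p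
        ≡⟨ ≡.cong (_+ length p) (solve 3 (λ k b w → k :* (con 1 :+ (b :* (con 2 :+ w) :+ b :* (con 2 :+ w)))
                                       := k :+ (k :* (con 2 :* (con 2 :+ w))) :* b) ≡.refl K (length B) ω) ⟩
      K + α * length B + length p ∎
      where
      open ≤-Reasoning
      c : ℕ
      c = productCostBound B
      c≤ : c ≤ length B * suc (suc ω)
      c≤ = productCostBound-≤ B (All.map (λ {f} h → inside-bag-≤ (scope f) (top x) h) B-in-bag)

    -- the table costs at most K + α·|B|, paid by the |B| - 1 removed factors and β
    budget′ : length p + α * length fs ≤ α * n + β * ∣ E ∣ → length p′ + α * suc (length A) ≤ α * n + β * ∣ E′ ∣
    budget′ budget = begin
      length p′ + α * suc (length A)
        ≤⟨ +-monoˡ-≤ (α * suc (length A)) table-cost ⟩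
      K + α * length B + length p + α * suc (length A)
        ≡⟨ solve 5 (λ k a lb lp la → k :+ a :* lb :+ lp :+ a :* (con 1 :+ la) := (lp :+ a :* (la :+ lb)) :+ (a :+ k))
             ≡.refl K α (length B) (length p) (length A) ⟩
      length p + α * (length A + length B) + β
        ≡⟨ ≡.cong (λ l → length p + α * l + β) (≡.sym (partition-length x fs)) ⟩
      length p + α * length fs + β
        ≤⟨ +-monoˡ-≤ β budget ⟩
      α * n + β * ∣ E ∣ + β
        ≡⟨ solve 3 (λ a b e → a :+ b :* e :+ b := a :+ b :* (con 1 :+ e)) ≡.refl (α * n) β ∣ E ∣ ⟩
      α * n + β * suc ∣ E ∣
        ≡⟨ ≡.cong (λ e → α * n + β * e) (≡.sym (∣insert∣ E x Ex)) ⟩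
      α * n + β * ∣ E′ ∣ ∎
      where open ≤-Reasoning

  eliminateColumn-tracked : ∀ j x s → Tracked s → DoneFrom (suc j) s → rank x ≡ j → lookup (State.eliminated s) x ≡ false →
                            Tracked (eliminateColumn x s)
  eliminateColumn-tracked j x (state p E fs) (tracked live cliques budget) done-above rank-x Ex =
    tracked live′ cliques′ (budget′ budget)
    where open Step j x p E fs live cliques done-above rank-x Ex

  eliminate-grows : ∀ x (E : Subset n) → Grows E (E [ x ]≔ true)
  eliminate-grows x E z Ez with z ≟ x
  ... | yes ≡.refl = lookup∘update z E true
  ... | no  z≢x    = ≡.trans (lookup∘update′ z≢x E true) Ez

  eliminateIfLive-tracked : ∀ j x s → Tracked s → DoneFrom (suc j) s → rank x ≡ j →
    Tracked (eliminateIfLive x s) × Grows (State.eliminated s) (State.eliminated (eliminateIfLive x s)) ×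
    lookup (State.eliminated (eliminateIfLive x s)) x ≡ true
  eliminateIfLive-tracked j x (state p E fs) tr done-above rank-x with lookup E x in Ex
  ... | true  = tr , (λ z Ez → Ez) , Ex
  ... | false = eliminateColumn-tracked j x (state p E fs) tr done-above rank-x Ex ,
                eliminate-grows x E , lookup∘update x E true

  pass-tracked : ∀ j xs s → Tracked s → DoneFrom (suc j) s →
    Tracked (pass rank j xs s) × Grows (State.eliminated s) (State.eliminated (pass rank j xs s)) ×
    (∀ x → x ∈L xs → rank x ≡ j → lookup (State.eliminated (pass rank j xs s)) x ≡ true)
  pass-tracked j []       s tr done-above = tr , (λ z Ez → Ez) , λ x ()
  pass-tracked j (x ∷ xs) s tr done-above with rank x ≟ℕ j
  ... | no rank-x≢j =
    let tr′ , grows , covered = pass-tracked j xs s tr done-above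
    in tr′ , grows , λ { y (here ≡.refl) rank-y → contradiction rank-y rank-x≢j ; y (there y∈xs) → covered y y∈xs }
  ... | yes rank-x =
    let tr₁ , grows₁ , x-eliminated = eliminateIfLive-tracked j x s tr done-above rank-x
        tr₂ , grows₂ , covered = pass-tracked j xs (eliminateIfLive x s) tr₁ (λ z le → grows₁ z (done-above z le))
    in tr₂ , (λ z → grows₂ z ∘ grows₁ z) ,
       λ { y (here ≡.refl) _ → grows₂ y x-eliminated ; y (there y∈xs) → covered y y∈xs }

  passes-tracked : ∀ j s → Tracked s → DoneFrom j s →
                   Tracked (passes rank j s) × (∀ z → lookup (State.eliminated (passes rank j s)) z ≡ true)
  passes-tracked zero    s tr done-above = tr , λ z → done-above z z≤n
  passes-tracked (suc j) s tr done-above =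
    let tr₁ , grows₁ , covered = pass-tracked j (allFin n) s tr done-above
    in passes-tracked j (pass rank j (allFin n) s) tr₁ (done-above′ grows₁ covered)
    where
    done-above′ : Grows (State.eliminated s) (State.eliminated (pass rank j (allFin n) s)) →
            (∀ x → x ∈L allFin n → rank x ≡ j → lookup (State.eliminated (pass rank j (allFin n) s)) x ≡ true) →
            DoneFrom j (pass rank j (allFin n) s)
    done-above′ grows covered z j≤z with rank z ≟ℕ j
    ... | yes rank-z = covered z (∈-allFin z) rank-z
    ... | no  rank-z≢j = grows z (done-above z (≤∧≢⇒< j≤z (rank-z≢j ∘ ≡.sym)))

  -- every scope S a is a clique: two columns of row a are adjacent in G^X
  row-clique : ∀ a → Clique (S a)
  row-clique a y z ay az with y ≟ z
  ... | yes ≡.refl = proj₁ (covers y) , proj₂ (covers y) , proj₂ (covers y)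
  ... | no  y≢z    = edges y z (y≢z , a , lookup⇒[]= y (S a) ay , lookup⇒[]= z (S a) az)

  initial-tracked : Tracked initial
  initial-tracked = tracked (rows-live (allFin n)) (rows-cliques (allFin n)) budget₀
    where
    rows-live : ∀ as → All (λ f → Live (replicate n false) (scope f)) (map rowF as)
    rows-live []       = []
    rows-live (a ∷ as) = (λ z _ → lookup-replicate z false) ∷ rows-live as
    rows-cliques : ∀ as → All (λ f → Clique (scope f)) (map rowF as)
    rows-cliques []       = []
    rows-cliques (a ∷ as) = row-clique a ∷ rows-cliques as
    budget₀ : 0 + α * length (map rowF (allFin n)) ≤ α * n + β * ∣ replicate n false ∣
    budget₀ rewrite length-map rowF (allFin n) | length-tabulate {n = n} id = m≤m+n (α * n) _

  N : ℕ
  N = numNodes T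

  initial-done : DoneFrom N initial
  initial-done z N≤z = contradiction (<-≤-trans (toℕ<n (top z)) N≤z) (<-irrefl ≡.refl)

  every-column-eliminated : ∀ z → lookup (State.eliminated (passes rank N initial)) z ≡ true
  every-column-eliminated = proj₂ (passes-tracked N initial initial-tracked initial-done)

  budget-≤ : α * n + β * n ≤ 18 * suc ω ^ 1 * n * 4 ^ ω
  budget-≤ = begin
    α * n + β * n
      ≡⟨ solve 3 (λ t w m → (con 2 :* t) :* (con 2 :* (con 2 :+ w)) :* m
                            :+ ((con 2 :* t) :* (con 2 :* (con 2 :+ w)) :+ con 2 :* t) :* m
                            := t :* (con 8 :* w :+ con 18) :* m) ≡.refl (2 ^ ω) ω n ⟩
    2 ^ ω * (8 * ω + 18) * n
      ≤⟨ *-monoˡ-≤ n (*-mono-≤ (^-monoˡ-≤ ω (s≤s (s≤s z≤n))) (+-monoˡ-≤ 18 (*-monoˡ-≤ ω (m≤m+n 8 10)))) ⟩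
    4 ^ ω * (18 * ω + 18) * n
      ≡⟨ solve 3 (λ u w m → u :* (con 18 :* w :+ con 18) :* m := con 18 :* ((con 1 :+ w) :* con 1) :* m :* u)
                 ≡.refl (4 ^ ω) ω n ⟩
    18 * suc ω ^ 1 * n * 4 ^ ω ∎
    where open ≤-Reasoning

  finalProgram-cost : Program.cost (finalProgram rank N) ≤ 18 * suc ω ^ 1 * n * 4 ^ ω
  finalProgram-cost = begin
    length (proj₁ (productAt fs (replicate n false) oneA p))
      ≤⟨ productAt-cost fs (replicate n false) oneA p ⟩
    productCost (replicate n false) fs + length p
      ≡⟨ ≡.cong (_+ length p) (productCost-∅ fs) ⟩
    length fs + length p
      ≤⟨ +-monoˡ-≤ (length p) (≤-trans (≤-reflexive (≡.sym (*-identityˡ (length fs)))) (*-monoˡ-≤ (length fs) 1≤α)) ⟩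
    α * length fs + length p
      ≡⟨ +-comm (α * length fs) (length p) ⟩
    length p + α * length fs
      ≤⟨ Tracked.budget (proj₁ (passes-tracked N initial initial-tracked initial-done)) ⟩
    α * n + β * ∣ E ∣
      ≤⟨ +-monoʳ-≤ (α * n) (*-monoʳ-≤ β (∣p∣≤n E)) ⟩
    α * n + β * n
      ≤⟨ budget-≤ ⟩
    18 * suc ω ^ 1 * n * 4 ^ ω ∎
    where
    open ≤-Reasoning
    s : State
    s = passes rank N initial
    p : Code n
    p = State.code s
    fs : List Factor
    fs = State.factors s
    E : Subset n
    E = State.eliminated s
    1≤α : 1 ≤ α
    1≤α = *-mono-≤ (m^n>0 2 (suc ω)) (s≤s z≤n)

open import Data.Nat using (_*_; _^_)

theorem3p7 : {c ℓ : Level} → (d : ℕ) →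
    ∃[ C ] ∃[ K ] ((n : ℕ) (S : Fin n → Subset n) (T : RootedTree)
      (χ : Node T → Subset n) (ω : ℕ) →
      IsTreeDecomposition (ColumnEdge S) T χ → HasWidth T χ ω →
      numNodes T ≤ d * n →
      Σ (Program n) λ P →
        (Program.cost P ≤ C * suc ω ^ K * n * 4 ^ ω) ×
        ((R : CommutativeRing c ℓ) (M : OverRing.Matrix R n) →
          OverRing.HasSupport R M S →
          CommutativeRing._≈_ R (OverRing.evalProgram R P M) (OverRing.Perm R M)))
theorem3p7 d = 18 , 1 , λ n S T χ ω decomposition width _ →
  let open Complexity S T χ decomposition ω width in
  Elimination.finalProgram S rank N ,
  finalProgram-cost ,
  λ R M support → Correctness.finalProgram-correct R S M support rank N every-column-eliminated
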